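{- For all integers $n$ and $k$ there is $\varepsilon\in\{1,-1\}$ such that $\binom{n}{k}_q = \varepsilon\sum_Y q^{\sigma(Y)-k(k-1)/2},$ where the sum is over all $k$-element (hybrid) subsets $Y$ of the standard new set $X_n$. Moreover, $\varepsilon=1$ if $0\le k\le n$; $\varepsilon=(-1)^k$ if $n<0\le k$; and $\varepsilon=(-1)^{n-k}$ if $k\le n<0$.
   Context: For an integer $n\ge 0$, $(a;q)_n=\prod_{j=0}^{n-1}(1-aq^j)$, and for $n<0$, $(a;q)_n=\prod_{j=1}^{|n|}\frac{1}{1-aq^{ -j}}$. For all integers $n,k$, $\binom{n}{k}_q := \lim_{a\to q} \frac{(a;q)_n}{(a;q)_k\,(a;q)_{n-k}}$ (a Laurent polynomial in $q$). A hybrid set $X$ (with elements from the integers) is a function $M_X:\mathbb{Z}\to\mathbb{Z}$ with finite support; $M_X(u)$ is the multiplicity of $u$, and the number of elements of $X$ is $\sum_u M_X(u)$. A hybrid set $Y$ is a subset of a hybrid set $X$ if $Y$ can be obtained from $X$ by repeatedly "removing" elements, or is the collection of removed elements, where removing an element $u$ means decreasing by one the current multiplicity of an element $u$ whose current multiplicity is nonzero. Equivalently: there is a function $r:\mathbb{Z}\to\mathbb{Z}_{\ge 0}$ with finite support such that $r(u)\le M_X(u)$ whenever $M_X(u)\ge 0$ (no restriction when $M_X(u)<0$), and either $M_Y=r$ or $M_Y=M_X-r$. A $k$-element subset is a subset with $\sum_u M_Y(u)=k$. The standard new set $X_n$ is: for $n\ge0$, the set $\{0,1,\dots,n-1\}$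 (each with multiplicity $1$); for $n<0$, the hybrid set in which each of $-1,-2,\dots,n$ has multiplicity $-1$ (and all other integers multiplicity $0$). For a hybrid set $Y$, $\sigma(Y)=\sum_{y} M_Y(y)\,y$. -}

module Defs where

open import Data.Bool using (Bool; true; false; if_then_else_; T)
open import Data.Nat as ℕ using (ℕ; zero; suc; _<ᵇ_; _≤ᵇ_)
import Data.Nat.Properties as ℕP
open import Data.Integer as ℤ using (ℤ; +_; -[1+_]; 0ℤ; 1ℤ; -1ℤ; _+_; _-_; _*_; -_; ∣_∣; _≤_; _<_)
open import Data.Product using (Σ; _×_; _,_; ∃)
open import Data.Sum using (_⊎_)
open import Data.List using (List; []; _∷_; _++_; map; concatMap)
open import Data.List.Relation.Unary.Any using (Any)
open import Data.List.Relation.Unary.AllPairs using (AllPairs)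
open import Relation.Nullary using (¬_; does)
open import Relation.Binary.PropositionalEquality using (_≡_; refl; subst)
open import Function.Bundles using (_⇔_)
open import Data.Empty using (⊥-elim)

-- Laurent polynomials in q over ℤ, as finite lists of terms
-- (exponent , coefficient); a list represents the sum of its terms.

LPoly : Set
LPoly = List (ℤ × ℤ)

coeff : LPoly → ℤ → ℤ
coeff []              e = 0ℤ
coeff ((d , c) ∷ p) e = (if does (d ℤ.≟ e) then c else 0ℤ) + coeff p e

_≈L_ : LPoly → LPoly → Set
p ≈L r = ∀ e → coeff p e ≡ coeff r e

zeroL : LPoly
zeroL = []

oneL : LPoly
oneL = (0ℤ , 1ℤ) ∷ []

_⊗_ : LPoly → LPoly → LPoly
p ⊗ r = concatMap (λ { (d , c) → map (λ { (d′ , c′) → (d + d′ , c * c′) }) r }) p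

_^L_ : LPoly → ℕ → LPoly
p ^L zero  = oneL
p ^L suc n = p ⊗ (p ^L n)

scaleL : ℤ → LPoly → LPoly
scaleL ε p = map (λ { (d , c) → (d , ε * c) }) p

oneMinusQ^ : ℤ → LPoly
oneMinusQ^ m = (0ℤ , 1ℤ) ∷ (m , -1ℤ) ∷ []

-- Rational functions of a (over Laurent polynomials in q) of the form
--   ∏ (1 - a q^j)^m   (a list of pairs (j , m), m ∈ ℤ).

FacList : Set
FacList = List (ℤ × ℤ)

invF : FacList → FacList
invF = map (λ { (j , m) → (j , - m) })

-- (a;q)_n :  n ≥ 0 : ∏_{j=0}^{n-1} (1 - a q^j)
--            n < 0 : ∏_{j=1}^{|n|} 1/(1 - a q^{-j})
pochPos : ℕ → FacList
pochPos zero    = []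
pochPos (suc n) = pochPos n ++ ((+ n , 1ℤ) ∷ [])

pochNeg : ℕ → FacList
pochNeg zero    = []
pochNeg (suc t) = pochNeg t ++ ((- (+ suc t) , -1ℤ) ∷ [])

poch : ℤ → FacList
poch (+ n)    = pochPos n
poch -[1+ n ] = pochNeg (suc n)

qbinomRatio : ℤ → ℤ → FacList
qbinomRatio n k = poch n ++ invF (poch k) ++ invF (poch (n - k))

-- The only factors vanishing at a = q are those with j = -1 (1 - a q^{-1}).
-- α = total exponent of (1 - a q^{-1});
-- num / den = value at a = q of the remaining factors (each 1 - q^{j+1} ≠ 0).
ordAtQ : FacList → ℤ
ordAtQ []              = 0ℤ
ordAtQ ((j , m) ∷ fs) = (if does (j ℤ.≟ -1ℤ) then m else 0ℤ) + ordAtQ fs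

numAtQ : FacList → LPoly
numAtQ []                = oneL
numAtQ ((j , + c) ∷ fs)  =
  if does (j ℤ.≟ -1ℤ) then numAtQ fs else (oneMinusQ^ (j + 1ℤ) ^L c) ⊗ numAtQ fs
numAtQ ((j , -[1+ c ]) ∷ fs) = numAtQ fs

denAtQ : FacList → LPoly
denAtQ []                = oneL
denAtQ ((j , + c) ∷ fs)  = denAtQ fs
denAtQ ((j , -[1+ c ]) ∷ fs) =
  if does (j ℤ.≟ -1ℤ) then denAtQ fs else (oneMinusQ^ (j + 1ℤ) ^L suc c) ⊗ denAtQ fs

-- lim_{a → q} F(a) = L   (L a Laurent polynomial in q):
-- F(a) = (1 - a/q)^α · num(a)/den(a) with num(q), den(q) ≠ 0; so the limit is
-- num(q)/den(q) if α = 0, is 0 if α > 0, and does not exist if α < 0.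
LimAtQ : FacList → LPoly → Set
LimAtQ F L =
  (ordAtQ F ≡ 0ℤ × numAtQ F ≈L (L ⊗ denAtQ F))
  ⊎ (0ℤ < ordAtQ F × L ≈L zeroL)

QBinomIs : ℤ → ℤ → LPoly → Set
QBinomIs n k L = LimAtQ (qbinomRatio n k) L

record HSet : Set where
  field
    mult  : ℤ → ℤ
    bound : ℕ
    supp  : ∀ u → bound ℕ.< ∣ u ∣ → mult u ≡ 0ℤ
open HSet public

symSum : ℕ → (ℤ → ℤ) → ℤ
symSum zero    f = f 0ℤ
symSum (suc B) f = f (+ suc B) + f (- (+ suc B)) + symSum B f

card : HSet → ℤ
card Y = symSum (bound Y) (mult Y)

σ : HSet → ℤ
σ Y = symSum (bound Y) (λ u → mult Y u * u)

_≐_ : HSet → HSet → Set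
X ≐ Y = ∀ u → mult X u ≡ mult Y u

IsSubsetOf : HSet → HSet → Set
IsSubsetOf Y X =
  Σ (ℤ → ℕ) λ r →
    (∃ λ B → ∀ u → B ℕ.< ∣ u ∣ → r u ≡ 0)
    × (∀ u → 0ℤ ≤ mult X u → + r u ≤ mult X u)
    × ((∀ u → mult Y u ≡ + r u) ⊎ (∀ u → mult Y u ≡ mult X u - + r u))

IsKSubsetOf : ℤ → HSet → HSet → Set
IsKSubsetOf k Y X = IsSubsetOf Y X × card Y ≡ k

multX : ℤ → ℤ → ℤ
multX (+ m)    (+ x)    = if x <ᵇ m then 1ℤ else 0ℤ
multX (+ m)    -[1+ x ] = 0ℤ
multX -[1+ m ] (+ x)    = 0ℤ
multX -[1+ m ] -[1+ x ] = if x ≤ᵇ m then -1ℤ else 0ℤ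

private
  suppX : ∀ n u → ∣ n ∣ ℕ.< ∣ u ∣ → multX n u ≡ 0ℤ
  suppX (+ m) (+ x) m<x with x <ᵇ m in eq
  ... | true  = ⊥-elim (ℕP.<-asym m<x (ℕP.<ᵇ⇒< x m (subst T (Relation.Binary.PropositionalEquality.sym eq) _)))
  ... | false = refl
  suppX (+ m) -[1+ x ] _ = refl
  suppX -[1+ m ] (+ x) _ = refl
  suppX -[1+ m ] -[1+ x ] (ℕ.s<s m<x) with x ≤ᵇ m in eq
  ... | true  = ⊥-elim (ℕP.<⇒≱ m<x (ℕP.≤ᵇ⇒≤ x m (subst T (Relation.Binary.PropositionalEquality.sym eq) _)))
  ... | false = refl

stdX : ℤ → HSet
stdX n = record { mult = multX n ; bound = ∣ n ∣ ; supp = suppX n }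

Enumerates : ℤ → HSet → List HSet → Set
Enumerates k X Ys =
  (∀ Y → IsKSubsetOf k Y X ⇔ Any (Y ≐_) Ys)
  × AllPairs (λ A B → ¬ (A ≐ B)) Ys

-- k(k-1)/2 (k(k-1) ≥ 0 is even for every integer k)
tri : ℤ → ℤ
tri k = + (∣ k * (k - 1ℤ) ∣ ℕ./ 2)

subsetSum : ℤ → List HSet → LPoly
subsetSum k Ys = map (λ Y → (σ Y - tri k , 1ℤ)) Ys

-- At a = q the factors 1 - a q^j of (a;q)_n are nonzero except 1 - a/q, so (a;q)_n is (1 - a/q)^e
-- times something whose value at q is (q;q)_n for n ≥ 0, with e = 0, and 1/(q⁻¹;q⁻¹)_m for n = -(m+1),
-- with e = -1.  Hence the q-binomial vanishes unless the powers of 1 - a/q cancel, and then it is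
--   (q;q)_n / ((q;q)_k (q;q)_{n-k})               for 0 ≤ k ≤ n,
--   (q⁻¹;q⁻¹)_{m+k} / ((q⁻¹;q⁻¹)_m (q;q)_k)       for n = -(m+1) < 0 ≤ k,
--   (q⁻¹;q⁻¹)_{m+t} / ((q⁻¹;q⁻¹)_m (q;q)_t)       for k = n - t ≤ n = -(m+1).
-- A k-subset of X_n is a 0/1-vector on {0, …, n-1} when n ≥ 0; when n < 0 it is either a multiset r
-- on {-1, …, n}, when k ≥ 0, or the complement X_n - r, when k < 0.  Splitting on the multiplicity of
-- the outermost point gives each generating polynomial Σ_Y q^{σ(Y) - k(k-1)/2} a q-Pascal recurrence,
-- and a double induction along it proves that the numerator above equals ± that polynomial times
-- the denominator.

module Submission where

open import Defs
open import Algebra.Bundles using (RawRing)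
import Algebra.Properties.AbelianGroup as AbelianGroupProperties
open import Algebra.Solver.Ring.AlmostCommutativeRing
  using (AlmostCommutativeRing; IsAlmostCommutativeRing; _-Raw-AlmostCommutative⟶_)
open import Data.Bool using (Bool; true; false; if_then_else_; _∨_; T)
import Data.Bool.Properties as Bool
open import Data.Empty using (⊥-elim)
open import Data.Integer as ℤ using (ℤ; +_; -[1+_]; 0ℤ; 1ℤ; -1ℤ; _+_; _-_; _*_; -_; _^_; ∣_∣; _≤_; _<_)
import Data.Integer.Properties as ℤP
open import Data.Integer.Tactic.RingSolver using (solve-∀)
open import Data.List using (List; []; _∷_; _++_; map)
import Data.List.Properties as List
open import Data.List.Membership.Propositional using (_∈_; lose; find)
open import Data.List.Membership.Propositional.Properties using (∈-map⁺; ∈-map⁻; ∈-++⁺ˡ; ∈-++⁺ʳ; ∈-++⁻)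
open import Data.List.Relation.Unary.All as All using (All)
import Data.List.Relation.Unary.All.Properties as All
open import Data.List.Relation.Unary.AllPairs as AllPairs using (AllPairs; []; _∷_)
import Data.List.Relation.Unary.AllPairs.Properties as AllPairs
open import Data.List.Relation.Unary.Any using (Any; here)
import Data.List.Relation.Unary.Any.Properties as Any
open import Data.Maybe using (Maybe; just; nothing)
open import Data.Nat as ℕ using (ℕ; zero; suc; z≤n; s≤s)
open import Data.Nat.DivMod using (m*n/n≡m)
import Data.Nat.Properties as ℕP
open import Data.Product using (Σ; _×_; _,_)
open import Data.Sum as Sum using (_⊎_; inj₁; inj₂)
open import Data.Vec as Vec using (Vec; []; _∷_)
import Data.Vec.Relation.Unary.All as VecAll
open import Function.Bundles using (mk⇔)
open import Function.Definitions using (Injective)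
open import Relation.Binary.Bundles using (Setoid)
open import Relation.Binary.PropositionalEquality
import Relation.Binary.Reasoning.Setoid as SetoidReasoning
open import Relation.Binary.Structures using (IsEquivalence)
open import Relation.Nullary using (does; yes; no; ¬_)
open import Relation.Nullary.Negation using (contradiction)

open AbelianGroupProperties ℤP.+-0-abelianGroup using (∙-cancelˡ)

-- Laurent polynomials as a commutative ring

[_≟_]_ : ℤ → ℤ → ℤ → ℤ
[ d ≟ e ] c = if does (d ℤ.≟ e) then c else 0ℤ

[≟]-+ : ∀ d e a b → [ d ≟ e ] (a + b) ≡ [ d ≟ e ] a + [ d ≟ e ] b
[≟]-+ d e a b with d ℤ.≟ e
... | yes _ = refl
... | no _  = refl

[≟]-* : ∀ d e k a → [ d ≟ e ] (k * a) ≡ k * [ d ≟ e ] a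
[≟]-* d e k a with d ℤ.≟ e
... | yes _ = refl
... | no _  = sym (ℤP.*-zeroʳ k)

[≟]-0 : ∀ d e → [ d ≟ e ] 0ℤ ≡ 0ℤ
[≟]-0 d e with d ℤ.≟ e
... | yes _ = refl
... | no _  = refl

[≟]-yes : ∀ w c → [ w ≟ w ] c ≡ c
[≟]-yes w c with w ℤ.≟ w
... | yes _  = refl
... | no w≢w = contradiction refl w≢w

[≟]-no : ∀ {w u} c → w ≢ u → [ w ≟ u ] c ≡ 0ℤ
[≟]-no {w} {u} c w≢u with w ℤ.≟ u
... | yes w≡u = contradiction w≡u w≢u
... | no _    = refl

[+≟]-shift : ∀ d d′ e c → [ d + d′ ≟ e ] c ≡ [ d′ ≟ e - d ] c
[+≟]-shift d d′ e c with d + d′ ℤ.≟ e | d′ ℤ.≟ e - d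
... | yes _ | yes _ = refl
... | no _  | no _  = refl
... | yes p | no ¬q = contradiction (trans (cancel d d′) (cong (_- d) p)) ¬q
  where
  cancel : ∀ d d′ → d′ ≡ d + d′ - d
  cancel = solve-∀
... | no ¬p | yes q = contradiction (trans (cong (_+_ d) q) (cancel d e)) ¬p
  where
  cancel : ∀ d e → d + (e - d) ≡ e
  cancel = solve-∀

term : ℤ → ℤ → LPoly
term d c = (d , c) ∷ []

coeff-++ : ∀ p r e → coeff (p ++ r) e ≡ coeff p e + coeff r e
coeff-++ []            r e = sym (ℤP.+-identityˡ _)
coeff-++ ((d , c) ∷ p) r e =
  trans (cong (_+_ ([ d ≟ e ] c)) (coeff-++ p r e)) (sym (ℤP.+-assoc ([ d ≟ e ] c) _ _))

coeff-term⊗ : ∀ d c r e → coeff (term d c ⊗ r) e ≡ c * coeff r (e - d)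
coeff-term⊗ d c []              e = sym (ℤP.*-zeroʳ c)
coeff-term⊗ d c ((d′ , c′) ∷ r) e = begin
  [ d + d′ ≟ e ] (c * c′) + coeff (term d c ⊗ r) e
    ≡⟨ cong₂ _+_ (trans ([+≟]-shift d d′ e _) ([≟]-* d′ (e - d) c c′)) (coeff-term⊗ d c r e) ⟩
  c * [ d′ ≟ e - d ] c′ + c * coeff r (e - d)
    ≡⟨ ℤP.*-distribˡ-+ c _ _ ⟨
  c * coeff ((d′ , c′) ∷ r) (e - d) ∎
  where open ≡-Reasoning

⊗-∷ : ∀ d c p r → ((d , c) ∷ p) ⊗ r ≡ (term d c ⊗ r) ++ (p ⊗ r)
⊗-∷ d c p r = cong (_++ (p ⊗ r)) (sym (List.++-identityʳ _))

convolve : LPoly → (ℤ → ℤ) → ℤ → ℤ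
convolve []            f e = 0ℤ
convolve ((d , c) ∷ p) f e = c * f (e - d) + convolve p f e

coeff-⊗ : ∀ p r e → coeff (p ⊗ r) e ≡ convolve p (coeff r) e
coeff-⊗ []            r e = refl
coeff-⊗ ((d , c) ∷ p) r e rewrite ⊗-∷ d c p r =
  trans (coeff-++ (term d c ⊗ r) (p ⊗ r) e) (cong₂ _+_ (coeff-term⊗ d c r e) (coeff-⊗ p r e))

convolve-cong : ∀ p {f g} → (∀ x → f x ≡ g x) → ∀ e → convolve p f e ≡ convolve p g e
convolve-cong []            f≗g e = refl
convolve-cong ((d , c) ∷ p) f≗g e = cong₂ _+_ (cong (c *_) (f≗g (e - d))) (convolve-cong p f≗g e)

convolve-++ : ∀ p r f e → convolve (p ++ r) f e ≡ convolve p f e + convolve r f e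
convolve-++ []            r f e = sym (ℤP.+-identityˡ _)
convolve-++ ((d , c) ∷ p) r f e =
  trans (cong (_+_ (c * f (e - d))) (convolve-++ p r f e)) (sym (ℤP.+-assoc (c * f (e - d)) _ _))

convolve-+ : ∀ p f g e → convolve p (λ x → f x + g x) e ≡ convolve p f e + convolve p g e
convolve-+ []            f g e = refl
convolve-+ ((d , c) ∷ p) f g e = trans (cong (_+_ (c * (f (e - d) + g (e - d)))) (convolve-+ p f g e))
  (regroup c (f (e - d)) (g (e - d)) (convolve p f e) (convolve p g e))
  where
  regroup : ∀ c a b x y → c * (a + b) + (x + y) ≡ c * a + x + (c * b + y)
  regroup = solve-∀

convolve-0 : ∀ p e → convolve p (λ _ → 0ℤ) e ≡ 0ℤ
convolve-0 []            e = refl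
convolve-0 ((d , c) ∷ p) e = cong₂ _+_ (ℤP.*-zeroʳ c) (convolve-0 p e)

convolve-term⊗ : ∀ d c r f e → convolve (term d c ⊗ r) f e ≡ c * convolve r f (e - d)
convolve-term⊗ d c []              f e = sym (ℤP.*-zeroʳ c)
convolve-term⊗ d c ((d′ , c′) ∷ r) f e =
  trans (cong₂ _+_ head (convolve-term⊗ d c r f e)) (sym (ℤP.*-distribˡ-+ c _ _))
  where
  shift : ∀ e d d′ → e - (d + d′) ≡ e - d - d′
  shift = solve-∀
  head : c * c′ * f (e - (d + d′)) ≡ c * (c′ * f (e - d - d′))
  head = trans (ℤP.*-assoc c c′ _) (cong (λ x → c * (c′ * f x)) (shift e d d′))

convolve-⊗ : ∀ p r f e → convolve (p ⊗ r) f e ≡ convolve p (convolve r f) e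
convolve-⊗ []            r f e = refl
convolve-⊗ ((d , c) ∷ p) r f e rewrite ⊗-∷ d c p r =
  trans (convolve-++ (term d c ⊗ r) (p ⊗ r) f e)
        (cong₂ _+_ (convolve-term⊗ d c r f e) (convolve-⊗ p r f e))

convolve-δ : ∀ r d c e → convolve r (λ x → [ d ≟ x ] c) e ≡ c * coeff r (e - d)
convolve-δ []              d c e = sym (ℤP.*-zeroʳ c)
convolve-δ ((d′ , c′) ∷ r) d c e =
  trans (cong₂ _+_ swap (convolve-δ r d c e)) (sym (ℤP.*-distribˡ-+ c _ _))
  where
  swap : c′ * [ d ≟ e - d′ ] c ≡ c * [ d′ ≟ e - d ] c′
  swap = begin
    c′ * [ d ≟ e - d′ ] c  ≡⟨ [≟]-* d (e - d′) c′ c ⟨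
    [ d ≟ e - d′ ] (c′ * c) ≡⟨ [+≟]-shift d′ d e _ ⟨
    [ d′ + d ≟ e ] (c′ * c) ≡⟨ cong₂ (λ x y → [ x ≟ e ] y) (ℤP.+-comm d′ d) (ℤP.*-comm c′ c) ⟩
    [ d + d′ ≟ e ] (c * c′) ≡⟨ [+≟]-shift d d′ e _ ⟩
    [ d′ ≟ e - d ] (c * c′) ≡⟨ [≟]-* d′ (e - d) c c′ ⟩
    c * [ d′ ≟ e - d ] c′   ∎
    where open ≡-Reasoning

convolve-comm : ∀ p r e → convolve p (coeff r) e ≡ convolve r (coeff p) e
convolve-comm []            r e = sym (convolve-0 r e)
convolve-comm ((d , c) ∷ p) r e = begin
  c * coeff r (e - d) + convolve p (coeff r) e
    ≡⟨ cong₂ _+_ (sym (convolve-δ r d c e)) (convolve-comm p r e) ⟩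
  convolve r (λ x → [ d ≟ x ] c) e + convolve r (coeff p) e
    ≡⟨ convolve-+ r (λ x → [ d ≟ x ] c) (coeff p) e ⟨
  convolve r (coeff ((d , c) ∷ p)) e ∎
  where open ≡-Reasoning

-- Wrapping _≈L_ in a record lets Agda infer both polynomials from an equality proof.
infix 4 _≋_
record _≋_ (p r : LPoly) : Set where
  constructor coeffwise
  field coeff-≡ : p ≈L r
open _≋_ public

≋-refl : ∀ {p} → p ≋ p
≋-refl = coeffwise λ _ → refl

≋-sym : ∀ {p r} → p ≋ r → r ≋ p
≋-sym (coeffwise h) = coeffwise λ e → sym (h e)

≋-trans : ∀ {p r s} → p ≋ r → r ≋ s → p ≋ s
≋-trans (coeffwise h) (coeffwise h′) = coeffwise λ e → trans (h e) (h′ e)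

≋-isEquivalence : IsEquivalence _≋_
≋-isEquivalence = record { refl = ≋-refl ; sym = ≋-sym ; trans = ≋-trans }

≋-setoid : Setoid _ _
≋-setoid = record { isEquivalence = ≋-isEquivalence }

-_L : LPoly → LPoly
-_L = scaleL -1ℤ

coeff-scaleL : ∀ k p e → coeff (scaleL k p) e ≡ k * coeff p e
coeff-scaleL k []            e = sym (ℤP.*-zeroʳ k)
coeff-scaleL k ((d , c) ∷ p) e =
  trans (cong₂ _+_ ([≟]-* d e k c) (coeff-scaleL k p e)) (sym (ℤP.*-distribˡ-+ k _ _))

convolve-scaleL : ∀ k p f e → convolve (scaleL k p) f e ≡ k * convolve p f e
convolve-scaleL k []            f e = sym (ℤP.*-zeroʳ k)
convolve-scaleL k ((d , c) ∷ p) f e =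
  trans (cong₂ _+_ (ℤP.*-assoc k c _) (convolve-scaleL k p f e)) (sym (ℤP.*-distribˡ-+ k _ _))

++-cong : ∀ {p p′ r r′} → p ≋ p′ → r ≋ r′ → p ++ r ≋ p′ ++ r′
++-cong {p} {p′} {r} {r′} (coeffwise h) (coeffwise h′) = coeffwise λ e →
  trans (coeff-++ p r e) (trans (cong₂ _+_ (h e) (h′ e)) (sym (coeff-++ p′ r′ e)))

++-comm : ∀ p r → p ++ r ≋ r ++ p
++-comm p r = coeffwise λ e →
  trans (coeff-++ p r e) (trans (ℤP.+-comm (coeff p e) _) (sym (coeff-++ r p e)))

⊗-comm : ∀ p r → p ⊗ r ≋ r ⊗ p
⊗-comm p r = coeffwise λ e →
  trans (coeff-⊗ p r e) (trans (convolve-comm p r e) (sym (coeff-⊗ r p e)))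

⊗-assoc : ∀ p r s → (p ⊗ r) ⊗ s ≋ p ⊗ (r ⊗ s)
⊗-assoc p r s = coeffwise λ e → begin
  coeff ((p ⊗ r) ⊗ s) e            ≡⟨ coeff-⊗ (p ⊗ r) s e ⟩
  convolve (p ⊗ r) (coeff s) e     ≡⟨ convolve-⊗ p r (coeff s) e ⟩
  convolve p (convolve r (coeff s)) e ≡⟨ convolve-cong p (λ x → sym (coeff-⊗ r s x)) e ⟩
  convolve p (coeff (r ⊗ s)) e     ≡⟨ coeff-⊗ p (r ⊗ s) e ⟨
  coeff (p ⊗ (r ⊗ s)) e            ∎
  where open ≡-Reasoning

⊗-congʳ : ∀ p {r s} → r ≋ s → p ⊗ r ≋ p ⊗ s
⊗-congʳ p {r} {s} (coeffwise h) = coeffwise λ e →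
  trans (coeff-⊗ p r e) (trans (convolve-cong p h e) (sym (coeff-⊗ p s e)))

⊗-cong : ∀ {p p′ r r′} → p ≋ p′ → r ≋ r′ → p ⊗ r ≋ p′ ⊗ r′
⊗-cong {p} {p′} {r} {r′} p≋p′ r≋r′ =
  ≋-trans (⊗-comm p r) (≋-trans (⊗-congʳ r p≋p′) (≋-trans (⊗-comm r p′) (⊗-congʳ p′ r≋r′)))

⊗-identityˡ : ∀ p → oneL ⊗ p ≋ p
⊗-identityˡ p = coeffwise λ e →
  trans (coeff-⊗ oneL p e) (trans (ℤP.+-identityʳ _)
    (trans (ℤP.*-identityˡ _) (cong (coeff p) (ℤP.+-identityʳ e))))

⊗-identityʳ : ∀ p → p ⊗ oneL ≋ p
⊗-identityʳ p = ≋-trans (⊗-comm p oneL) (⊗-identityˡ p)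

⊗-distribˡ : ∀ p r s → p ⊗ (r ++ s) ≋ (p ⊗ r) ++ (p ⊗ s)
⊗-distribˡ p r s = coeffwise λ e → begin
  coeff (p ⊗ (r ++ s)) e                              ≡⟨ coeff-⊗ p (r ++ s) e ⟩
  convolve p (coeff (r ++ s)) e                       ≡⟨ convolve-cong p (coeff-++ r s) e ⟩
  convolve p (λ x → coeff r x + coeff s x) e          ≡⟨ convolve-+ p (coeff r) (coeff s) e ⟩
  convolve p (coeff r) e + convolve p (coeff s) e     ≡⟨ cong₂ _+_ (coeff-⊗ p r e) (coeff-⊗ p s e) ⟨
  coeff (p ⊗ r) e + coeff (p ⊗ s) e                   ≡⟨ coeff-++ (p ⊗ r) (p ⊗ s) e ⟨
  coeff ((p ⊗ r) ++ (p ⊗ s)) e                        ∎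
  where open ≡-Reasoning

-L-cong : ∀ {p r} → p ≋ r → - p L ≋ - r L
-L-cong {p} {r} (coeffwise h) = coeffwise λ e →
  trans (coeff-scaleL -1ℤ p e) (trans (cong (-1ℤ *_) (h e)) (sym (coeff-scaleL -1ℤ r e)))

-L-⊗ : ∀ p r → (- p L) ⊗ r ≋ - (p ⊗ r) L
-L-⊗ p r = coeffwise λ e →
  trans (coeff-⊗ (- p L) r e) (trans (convolve-scaleL -1ℤ p (coeff r) e)
    (trans (cong (-1ℤ *_) (sym (coeff-⊗ p r e))) (sym (coeff-scaleL -1ℤ (p ⊗ r) e))))

-L-++ : ∀ p r → (- p L) ++ (- r L) ≋ - (p ++ r) L
-L-++ p r = coeffwise λ e → begin
  coeff ((- p L) ++ (- r L)) e         ≡⟨ coeff-++ (- p L) (- r L) e ⟩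
  coeff (- p L) e + coeff (- r L) e    ≡⟨ cong₂ _+_ (coeff-scaleL -1ℤ p e) (coeff-scaleL -1ℤ r e) ⟩
  -1ℤ * coeff p e + -1ℤ * coeff r e    ≡⟨ ℤP.*-distribˡ-+ -1ℤ (coeff p e) (coeff r e) ⟨
  -1ℤ * (coeff p e + coeff r e)        ≡⟨ cong (-1ℤ *_) (coeff-++ p r e) ⟨
  -1ℤ * coeff (p ++ r) e               ≡⟨ coeff-scaleL -1ℤ (p ++ r) e ⟨
  coeff (- (p ++ r) L) e               ∎
  where open ≡-Reasoning

LPoly-isAlmostCommutativeRing : IsAlmostCommutativeRing _≋_ _++_ _⊗_ -_L [] oneL
LPoly-isAlmostCommutativeRing = record
  { isCommutativeSemiring = record
    { isSemiring = record
      { isSemiringWithoutAnnihilatingZero = record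
        { +-isCommutativeMonoid = record
          { isMonoid = record
            { isSemigroup = record
              { isMagma = record { isEquivalence = ≋-isEquivalence ; ∙-cong = ++-cong }
              ; assoc = λ p r s → coeffwise λ e → cong (λ x → coeff x e) (List.++-assoc p r s) }
            ; identity = (λ p → ≋-refl) , (λ p → coeffwise λ e → cong (λ x → coeff x e) (List.++-identityʳ p)) }
          ; comm = ++-comm }
        ; *-cong = ⊗-cong
        ; *-assoc = ⊗-assoc
        ; *-identity = ⊗-identityˡ , ⊗-identityʳ
        ; distrib = ⊗-distribˡ
                  , (λ p r s → ≋-trans (⊗-comm (r ++ s) p) (≋-trans (⊗-distribˡ p r s) (++-cong (⊗-comm p r) (⊗-comm p s)))) }
      ; zero = (λ p → ≋-refl) , (λ p → ⊗-comm p []) }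
    ; *-comm = ⊗-comm }
  ; -‿cong = -L-cong
  ; -‿*-distribˡ = -L-⊗
  ; -‿+-comm = -L-++ }

LPoly-ring : AlmostCommutativeRing _ _
LPoly-ring = record { isAlmostCommutativeRing = LPoly-isAlmostCommutativeRing }

cst : ℤ → LPoly
cst = term 0ℤ

coeff-cst : ∀ c e → coeff (cst c) e ≡ [ 0ℤ ≟ e ] c
coeff-cst c e = ℤP.+-identityʳ _

cst-⊗ : ∀ a p → cst a ⊗ p ≋ scaleL a p
cst-⊗ a p = coeffwise λ e → trans (coeff-term⊗ 0ℤ a p e)
  (trans (cong (λ x → a * coeff p x) (ℤP.+-identityʳ e)) (sym (coeff-scaleL a p e)))

scaleL-1 : ∀ p → scaleL 1ℤ p ≋ p
scaleL-1 p = ≋-trans (≋-sym (cst-⊗ 1ℤ p)) (⊗-identityˡ p)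

ℤ-rawRing : RawRing _ _
ℤ-rawRing = record { Carrier = ℤ ; _≈_ = _≡_ ; _+_ = _+_ ; _*_ = _*_ ; -_ = -_ ; 0# = 0ℤ ; 1# = 1ℤ }

cst-homomorphism : ℤ-rawRing -Raw-AlmostCommutative⟶ LPoly-ring
cst-homomorphism = record
  { ⟦_⟧    = cst
  ; +-homo = λ a b → coeffwise λ e → trans (coeff-cst (a + b) e) (trans ([≟]-+ 0ℤ e a b)
               (sym (trans (coeff-++ (cst a) (cst b) e) (cong₂ _+_ (coeff-cst a e) (coeff-cst b e)))))
  ; *-homo = λ a b → coeffwise λ e → trans (coeff-cst (a * b) e) (trans ([≟]-* 0ℤ e a b)
               (sym (trans (coeff-≡ (cst-⊗ a (cst b)) e)
                 (trans (coeff-scaleL a (cst b) e) (cong (_*_ a) (coeff-cst b e))))))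
  ; -‿homo = λ a → coeffwise λ e → trans (coeff-cst (- a) e) (trans (cong ([ 0ℤ ≟ e ]_) (sym (ℤP.-1*i≡-i a)))
               (trans ([≟]-* 0ℤ e -1ℤ a)
               (sym (trans (coeff-scaleL -1ℤ (cst a) e) (cong (_*_ -1ℤ) (coeff-cst a e))))))
  ; 0-homo = coeffwise λ e → trans (coeff-cst 0ℤ e) ([≟]-0 0ℤ e)
  ; 1-homo = ≋-refl
  }

cst-≟ : ∀ a b → Maybe (cst a ≋ cst b)
cst-≟ a b with a ℤ.≟ b
... | yes refl = just ≋-refl
... | no _     = nothing

open import Algebra.Solver.Ring ℤ-rawRing LPoly-ring cst-homomorphism cst-≟

-- _⊗_ comes without a fixity declaration; this alias associates to the left.
infixl 7 _·_
_·_ : LPoly → LPoly → LPoly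
_·_ = _⊗_

infix 8 1-_
1-_ : LPoly → LPoly
1- p = oneL ++ - p L

infix 9 q^_
q^_ : ℤ → LPoly
q^ a = term a 1ℤ

q^-cong : ∀ {a b} → a ≡ b → q^ a ≋ q^ b
q^-cong refl = ≋-refl

≡⇒≋ : ∀ {p r} → p ≡ r → p ≋ r
≡⇒≋ refl = ≋-refl

-- Triangular numbers and q-factorials

triangle : ℕ → ℕ
triangle zero    = 0
triangle (suc n) = triangle n ℕ.+ n

pronic≡2*triangle : ∀ n → + n * (+ n - 1ℤ) ≡ + (triangle n ℕ.* 2)
pronic≡2*triangle zero    = refl
pronic≡2*triangle (suc n) = begin
  + suc n * (+ suc n - 1ℤ)           ≡⟨ cong (λ x → x * (x - 1ℤ)) (ℤP.pos-+ 1 n) ⟩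
  (1ℤ + + n) * (1ℤ + + n - 1ℤ)       ≡⟨ expand (+ n) ⟩
  + n * (+ n - 1ℤ) + + n * + 2       ≡⟨ cong₂ _+_ (pronic≡2*triangle n) (sym (ℤP.pos-* n 2)) ⟩
  + (triangle n ℕ.* 2) + + (n ℕ.* 2) ≡⟨ ℤP.pos-+ (triangle n ℕ.* 2) (n ℕ.* 2) ⟨
  + (triangle n ℕ.* 2 ℕ.+ n ℕ.* 2)   ≡⟨ cong +_ (ℕP.*-distribʳ-+ 2 (triangle n) n) ⟨
  + (triangle (suc n) ℕ.* 2)         ∎
  where
  open ≡-Reasoning
  expand : ∀ n → (1ℤ + n) * (1ℤ + n - 1ℤ) ≡ n * (n - 1ℤ) + n * + 2
  expand = solve-∀

tri*2-of-pronic : ∀ k n → k * (k - 1ℤ) ≡ + (triangle n ℕ.* 2) → tri k * + 2 ≡ k * (k - 1ℤ)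
tri*2-of-pronic k n eq = begin
  tri k * + 2                        ≡⟨ cong (λ x → + (∣ x ∣ ℕ./ 2) * + 2) eq ⟩
  + (triangle n ℕ.* 2 ℕ./ 2) * + 2   ≡⟨ cong (λ x → + x * + 2) (m*n/n≡m (triangle n) 2) ⟩
  + triangle n * + 2                 ≡⟨ ℤP.pos-* (triangle n) 2 ⟨
  + (triangle n ℕ.* 2)               ≡⟨ eq ⟨
  k * (k - 1ℤ)                       ∎
  where open ≡-Reasoning

tri*2 : ∀ k → tri k * + 2 ≡ k * (k - 1ℤ)
tri*2 (+ n)      = tri*2-of-pronic (+ n) n (pronic≡2*triangle n)
tri*2 -[1+ j ]   = tri*2-of-pronic -[1+ j ] (suc (suc j))
  (trans (mirror -[1+ j ]) (pronic≡2*triangle (suc (suc j))))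
  where
  mirror : ∀ k → k * (k - 1ℤ) ≡ (1ℤ - k) * (1ℤ - k - 1ℤ)
  mirror = solve-∀

tri-suc : ∀ k → tri (k + 1ℤ) ≡ tri k + k
tri-suc k = ℤP.*-cancelʳ-≡ _ _ (+ 2) (begin
  tri (k + 1ℤ) * + 2          ≡⟨ tri*2 (k + 1ℤ) ⟩
  (k + 1ℤ) * (k + 1ℤ - 1ℤ)    ≡⟨ expand k ⟩
  k * (k - 1ℤ) + k * + 2      ≡⟨ cong (_+ k * + 2) (tri*2 k) ⟨
  tri k * + 2 + k * + 2       ≡⟨ ℤP.*-distribʳ-+ (+ 2) (tri k) k ⟨
  (tri k + k) * + 2           ∎)
  where
  open ≡-Reasoning
  expand : ∀ k → (k + 1ℤ) * (k + 1ℤ - 1ℤ) ≡ k * (k - 1ℤ) + k * + 2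
  expand = solve-∀

tri-suc⁺ : ∀ k → tri (+ suc k) ≡ tri (+ k) + + k
tri-suc⁺ k = trans (cong (λ n → tri (+ n)) (ℕP.+-comm 1 k)) (tri-suc (+ k))

tri-suc⁻ : ∀ K → tri (- + suc K) ≡ tri (- + K) + + suc K
tri-suc⁻ K = begin
  tri (- + suc K)                            ≡⟨ cancel (tri (- + suc K)) (- + suc K) ⟩
  tri (- + suc K) + - + suc K - - + suc K    ≡⟨ cong (_- - + suc K) (tri-suc (- + suc K)) ⟨
  tri (- + suc K + 1ℤ) - - + suc K           ≡⟨ cong (λ k → tri k + + suc K) (step K) ⟩
  tri (- + K) + + suc K                      ∎
  where
  open ≡-Reasoning
  cancel : ∀ t k → t ≡ t + k - k
  cancel = solve-∀
  step′ : ∀ K → - (1ℤ + K) + 1ℤ ≡ - K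
  step′ = solve-∀
  step : ∀ K → - + suc K + 1ℤ ≡ - + K
  step K = trans (cong (λ x → - x + 1ℤ) (ℤP.pos-+ 1 K)) (step′ (+ K))

qfac : ℕ → LPoly
qfac zero    = oneL
qfac (suc n) = qfac n · oneMinusQ^ (+ suc n)

qfac⁻ : ℕ → LPoly
qfac⁻ zero    = oneL
qfac⁻ (suc n) = qfac⁻ n · oneMinusQ^ -[1+ n ]

-- (-1)^k, defined so that the ring solver sees sign (suc k) as the negation of sign k.
sign : ℕ → LPoly
sign zero    = oneL
sign (suc k) = - sign k L

sign≋cst : ∀ k → sign k ≋ cst (-1ℤ ^ k)
sign≋cst zero    = ≋-refl
sign≋cst (suc k) = -L-cong (sign≋cst k)

sign-⊗ : ∀ k p → sign k · p ≋ scaleL (-1ℤ ^ k) p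
sign-⊗ k p = ≋-trans (⊗-cong (sign≋cst k) ≋-refl) (cst-⊗ (-1ℤ ^ k) p)

-- Generating polynomials of vectors and their q-Pascal recurrences

choose : (N k : ℕ) → List (Vec ℕ N)
choose zero    zero    = [] ∷ []
choose zero    (suc k) = []
choose (suc N) zero    = map (0 ∷_) (choose N zero)
choose (suc N) (suc k) = map (0 ∷_) (choose N (suc k)) ++ map (1 ∷_) (choose N k)

choose-empty : ∀ N k → N ℕ.< k → choose N k ≡ []
choose-empty zero    (suc k) _            = refl
choose-empty (suc N) (suc k) (s≤s N<k)
  rewrite choose-empty N (suc k) (ℕP.m<n⇒m<1+n N<k) | choose-empty N k N<k = refl

incrHead : ∀ {N} → Vec ℕ (suc N) → Vec ℕ (suc N)
incrHead (v ∷ l) = suc v ∷ l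

multichoose : (N k : ℕ) → List (Vec ℕ N)
multichoose zero    zero    = [] ∷ []
multichoose zero    (suc k) = []
multichoose (suc N) zero    = map (0 ∷_) (multichoose N zero)
multichoose (suc N) (suc k) = map (0 ∷_) (multichoose N (suc k)) ++ map incrHead (multichoose (suc N) k)

-- σ of the hybrid set with multiplicity v_i at pos i, the head of a vector of length N + 1 sitting
-- at pos N; exponent is then the exponent σ(Y) - k(k-1)/2 of the theorem.
weight : (ℕ → ℤ) → ∀ {N} → Vec ℤ N → ℤ
weight pos []              = 0ℤ
weight pos {suc N} (v ∷ l) = v * pos N + weight pos l

exponent : (pos g : ℕ → ℤ) → ℤ → ∀ {N} → Vec ℕ N → ℤ
exponent pos g k l = weight pos (Vec.map g l) - tri k

expPoly : ∀ {A : Set} → (A → ℤ) → List A → LPoly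
expPoly w = map (λ a → (w a , 1ℤ))

expPoly-++ : ∀ {A : Set} (w : A → ℤ) xs ys → expPoly w (xs ++ ys) ≋ expPoly w xs ++ expPoly w ys
expPoly-++ w xs ys = ≡⇒≋ (List.map-++ _ xs ys)

expPoly-shift : ∀ {A B : Set} (f : A → B) {w : A → ℤ} {w′ : B → ℤ} c xs →
  (∀ a → w′ (f a) ≡ c + w a) → expPoly w′ (map f xs) ≋ q^ c · expPoly w xs
expPoly-shift f {w} {w′} c xs shift = coeffwise λ e →
  trans (shifted xs e) (sym (trans (coeff-term⊗ c 1ℤ (expPoly w xs) e) (ℤP.*-identityˡ _)))
  where
  shifted : ∀ xs e → coeff (expPoly w′ (map f xs)) e ≡ coeff (expPoly w xs) (e - c)
  shifted []       e = refl
  shifted (a ∷ xs) e =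
    cong₂ _+_ (trans (cong (λ x → [ x ≟ e ] 1ℤ) (shift a)) ([+≟]-shift c (w a) e 1ℤ)) (shifted xs e)

expPoly-0∷ : ∀ pos g k {N} (ls : List (Vec ℕ N)) → g 0 ≡ 0ℤ →
  expPoly (exponent pos g k) (map (0 ∷_) ls) ≋ expPoly (exponent pos g k) ls
expPoly-0∷ pos g k {N} ls g0≡0 =
  ≋-trans (expPoly-shift (0 ∷_) 0ℤ ls shift) (⊗-identityˡ _)
  where
  drop : ∀ p w t → 0ℤ * p + w - t ≡ 0ℤ + (w - t)
  drop = solve-∀
  shift : ∀ l → exponent pos g k (0 ∷ l) ≡ 0ℤ + exponent pos g k l
  shift l = trans (cong (λ x → x * pos N + weight pos (Vec.map g l) - tri k) g0≡0)
                  (drop (pos N) (weight pos (Vec.map g l)) (tri k))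

subsetPoly : ℕ → ℕ → LPoly
subsetPoly N k = expPoly (exponent +_ +_ (+ k)) (choose N k)

multisetPoly : ℕ → ℕ → LPoly
multisetPoly N k = expPoly (exponent -[1+_] +_ (+ k)) (multichoose N k)

complementPoly : ℕ → ℕ → LPoly
complementPoly N t = expPoly (exponent -[1+_] -[1+_] (- + (N ℕ.+ t))) (multichoose N t)

subsetPoly-0 : ∀ N → subsetPoly N 0 ≋ oneL
subsetPoly-0 zero    = ≋-refl
subsetPoly-0 (suc N) = ≋-trans (expPoly-0∷ +_ +_ (+ 0) (choose N 0) refl) (subsetPoly-0 N)

subsetPoly-suc : ∀ k d →
  subsetPoly (suc (k ℕ.+ d)) (suc k) ≋ subsetPoly (k ℕ.+ d) (suc k) ++ q^ (+ d) · subsetPoly (k ℕ.+ d) k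
subsetPoly-suc k d = ≋-trans (expPoly-++ _ (map (0 ∷_) (choose (k ℕ.+ d) (suc k))) _)
  (++-cong (expPoly-0∷ +_ +_ (+ suc k) (choose (k ℕ.+ d) (suc k)) refl) (expPoly-shift (1 ∷_) (+ d) _ shift))
  where
  regroup : ∀ k d w t → 1ℤ * (k + d) + w - (t + k) ≡ d + (w - t)
  regroup = solve-∀
  shift : ∀ l → exponent +_ +_ (+ suc k) (1 ∷ l) ≡ + d + exponent +_ +_ (+ k) l
  shift l = trans (cong₂ (λ n t → 1ℤ * n + weight +_ (Vec.map +_ l) - t) (ℤP.pos-+ k d) (tri-suc⁺ k))
                  (regroup (+ k) (+ d) (weight +_ (Vec.map +_ l)) (tri (+ k)))

subsetPoly-diag : ∀ N → subsetPoly N N ≋ oneL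
subsetPoly-diag zero    = ≋-refl
subsetPoly-diag (suc N) = begin
  subsetPoly (suc N) (suc N)
    ≡⟨ cong (λ n → subsetPoly (suc n) (suc N)) (ℕP.+-identityʳ N) ⟨
  subsetPoly (suc (N ℕ.+ 0)) (suc N)
    ≈⟨ subsetPoly-suc N 0 ⟩
  subsetPoly (N ℕ.+ 0) (suc N) ++ q^ 0ℤ · subsetPoly (N ℕ.+ 0) N
    ≡⟨ cong (λ n → subsetPoly n (suc N) ++ q^ 0ℤ · subsetPoly n N) (ℕP.+-identityʳ N) ⟩
  subsetPoly N (suc N) ++ q^ 0ℤ · subsetPoly N N
    ≈⟨ ++-cong (≡⇒≋ (cong (expPoly _) (choose-empty N (suc N) ℕP.≤-refl))) (⊗-congʳ oneL (subsetPoly-diag N)) ⟩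
  oneL ∎
  where open SetoidReasoning ≋-setoid

multisetPoly-0 : ∀ N → multisetPoly N 0 ≋ oneL
multisetPoly-0 zero    = ≋-refl
multisetPoly-0 (suc N) = ≋-trans (expPoly-0∷ -[1+_] +_ (+ 0) (multichoose N 0) refl) (multisetPoly-0 N)

multisetPoly-suc : ∀ N k →
  multisetPoly (suc N) (suc k) ≋ multisetPoly N (suc k) ++ q^ -[1+ N ℕ.+ k ] · multisetPoly (suc N) k
multisetPoly-suc N k = ≋-trans (expPoly-++ _ (map (0 ∷_) (multichoose N (suc k))) _)
  (++-cong (expPoly-0∷ -[1+_] +_ (+ suc k) (multichoose N (suc k)) refl)
           (expPoly-shift incrHead -[1+ N ℕ.+ k ] (multichoose (suc N) k) shift))
  where
  regroup : ∀ v p k w t → (1ℤ + v) * p + w - (t + k) ≡ (p - k) + (v * p + w - t)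
  regroup = solve-∀
  shift : ∀ l → exponent -[1+_] +_ (+ suc k) (incrHead l) ≡ -[1+ N ℕ.+ k ] + exponent -[1+_] +_ (+ k) l
  shift (v ∷ l) = begin
    + suc v * -[1+ N ] + w - tri (+ suc k)      ≡⟨ cong₂ (λ x t → x * -[1+ N ] + w - t) (ℤP.pos-+ 1 v) (tri-suc⁺ k) ⟩
    (1ℤ + + v) * -[1+ N ] + w - (tri (+ k) + + k) ≡⟨ regroup (+ v) -[1+ N ] (+ k) w (tri (+ k)) ⟩
    (-[1+ N ] - + k) + (+ v * -[1+ N ] + w - tri (+ k))
      ≡⟨ cong (_+ (+ v * -[1+ N ] + w - tri (+ k))) (trans (ℤP.neg-minus-pos N k) (cong -[1+_] (ℕP.+-comm k N))) ⟩
    -[1+ N ℕ.+ k ] + (+ v * -[1+ N ] + w - tri (+ k)) ∎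
    where
    open ≡-Reasoning
    w = weight -[1+_] (Vec.map +_ l)

minus-gap : ∀ N t → + N - + (N ℕ.+ suc t) ≡ -[1+ t ]
minus-gap N t = begin
  + N - + (N ℕ.+ suc t)         ≡⟨ cong (λ x → + N - x) (trans (ℤP.pos-+ N (suc t)) (cong (_+_ (+ N)) (ℤP.pos-+ 1 t))) ⟩
  + N - (+ N + (1ℤ + + t))      ≡⟨ cancel (+ N) (+ t) ⟩
  - (1ℤ + + t)                  ≡⟨ cong -_ (ℤP.pos-+ 1 t) ⟨
  -[1+ t ]                      ∎
  where
  open ≡-Reasoning
  cancel : ∀ n t → n - (n + (1ℤ + t)) ≡ - (1ℤ + t)
  cancel = solve-∀

exponent-0∷⁻ : ∀ {N} K (l : Vec ℕ N) →
  exponent -[1+_] -[1+_] (- + suc K) (0 ∷ l) ≡ (+ N - + K) + exponent -[1+_] -[1+_] (- + K) l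
exponent-0∷⁻ {N} K l = begin
  -1ℤ * -[1+ N ] + w - tri (- + suc K)              ≡⟨ cong (λ t → -1ℤ * -[1+ N ] + w - t) (tri-suc⁻ K) ⟩
  -1ℤ * -[1+ N ] + w - (tri (- + K) + + suc K)      ≡⟨ cong₂ (λ p s → -1ℤ * - p + w - (tri (- + K) + s)) (ℤP.pos-+ 1 N) (ℤP.pos-+ 1 K) ⟩
  -1ℤ * - (1ℤ + + N) + w - (tri (- + K) + (1ℤ + + K)) ≡⟨ regroup (+ N) (+ K) w (tri (- + K)) ⟩
  (+ N - + K) + (w - tri (- + K))                   ∎
  where
  open ≡-Reasoning
  w = weight -[1+_] (Vec.map -[1+_] l)
  regroup : ∀ n k w t → -1ℤ * - (1ℤ + n) + w - (t + (1ℤ + k)) ≡ (n - k) + (w - t)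
  regroup = solve-∀

exponent-incrHead⁻ : ∀ {N} K (l : Vec ℕ (suc N)) →
  exponent -[1+_] -[1+_] (- + suc K) (incrHead l) ≡ (+ N - + K) + exponent -[1+_] -[1+_] (- + K) l
exponent-incrHead⁻ {N} K (v ∷ l) = begin
  -[1+ suc v ] * -[1+ N ] + w - tri (- + suc K)
    ≡⟨ cong (λ t → -[1+ suc v ] * -[1+ N ] + w - t) (tri-suc⁻ K) ⟩
  -[1+ suc v ] * -[1+ N ] + w - (tri (- + K) + + suc K)
    ≡⟨ cong₂ (λ a p → a * - p + w - (tri (- + K) + + suc K)) (sym (ℤP.neg-minus-pos v 1)) (ℤP.pos-+ 1 N) ⟩
  (-[1+ v ] - 1ℤ) * - (1ℤ + + N) + w - (tri (- + K) + + suc K)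
    ≡⟨ cong (λ s → (-[1+ v ] - 1ℤ) * - (1ℤ + + N) + w - (tri (- + K) + s)) (ℤP.pos-+ 1 K) ⟩
  (-[1+ v ] - 1ℤ) * - (1ℤ + + N) + w - (tri (- + K) + (1ℤ + + K))
    ≡⟨ regroup -[1+ v ] (+ N) (+ K) w (tri (- + K)) ⟩
  (+ N - + K) + (-[1+ v ] * - (1ℤ + + N) + w - tri (- + K))
    ≡⟨ cong (λ p → (+ N - + K) + (-[1+ v ] * - p + w - tri (- + K))) (ℤP.pos-+ 1 N) ⟨
  (+ N - + K) + (-[1+ v ] * -[1+ N ] + w - tri (- + K)) ∎
  where
  open ≡-Reasoning
  w = weight -[1+_] (Vec.map -[1+_] l)
  regroup : ∀ a n k w t → (a - 1ℤ) * - (1ℤ + n) + w - (t + (1ℤ + k)) ≡ (n - k) + (a * - (1ℤ + n) + w - t)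
  regroup = solve-∀

complementPoly-0 : ∀ N → complementPoly N 0 ≋ oneL
complementPoly-0 zero    = ≋-refl
complementPoly-0 (suc N) =
  ≋-trans (expPoly-shift (0 ∷_) 0ℤ (multichoose N 0) shift) (≋-trans (⊗-identityˡ _) (complementPoly-0 N))
  where
  no-gap : + N - + (N ℕ.+ 0) ≡ 0ℤ
  no-gap = trans (cong (λ n → + N - + n) (ℕP.+-identityʳ N)) (ℤP.+-inverseʳ (+ N))
  shift : ∀ l →
    exponent -[1+_] -[1+_] (- + (suc N ℕ.+ 0)) (0 ∷ l) ≡ 0ℤ + exponent -[1+_] -[1+_] (- + (N ℕ.+ 0)) l
  shift l = trans (exponent-0∷⁻ (N ℕ.+ 0) l) (cong (_+ exponent -[1+_] -[1+_] (- + (N ℕ.+ 0)) l) no-gap)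

complementPoly-suc : ∀ N t →
  complementPoly (suc N) (suc t) ≋ q^ -[1+ t ] · (complementPoly N (suc t) ++ complementPoly (suc N) t)
complementPoly-suc N t =
  ≋-trans (expPoly-++ _ (map (0 ∷_) (multichoose N (suc t))) _)
  (≋-trans (++-cong (expPoly-shift (0 ∷_) -[1+ t ] (multichoose N (suc t)) shift₀)
                    (expPoly-shift incrHead -[1+ t ] (multichoose (suc N) t) shift₁))
           (≋-sym (⊗-distribˡ (q^ -[1+ t ]) (complementPoly N (suc t)) (complementPoly (suc N) t))))
  where
  C = exponent -[1+_] -[1+_]
  shift₀ : ∀ l → C (- + (suc N ℕ.+ suc t)) (0 ∷ l) ≡ -[1+ t ] + C (- + (N ℕ.+ suc t)) l
  shift₀ l = trans (exponent-0∷⁻ (N ℕ.+ suc t) l) (cong (_+ C (- + (N ℕ.+ suc t)) l) (minus-gap N t))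
  shift₁ : ∀ l → C (- + (suc N ℕ.+ suc t)) (incrHead l) ≡ -[1+ t ] + C (- + (suc N ℕ.+ t)) l
  shift₁ l = trans (cong (λ n → C (- + n) (incrHead l)) (ℕP.+-suc (suc N) t))
    (trans (exponent-incrHead⁻ (suc N ℕ.+ t) l)
           (cong (_+ C (- + (suc N ℕ.+ t)) l) (trans (cong (λ n → + N - + n) (sym (ℕP.+-suc N t))) (minus-gap N t))))

-- Factorising the q-factorials

1-‿cong : ∀ {p r} → p ≋ r → 1- p ≋ 1- r
1-‿cong p≋r = ++-cong ≋-refl (-L-cong p≋r)

qfac-split : ∀ k d → qfac (k ℕ.+ d) ≋ subsetPoly (k ℕ.+ d) k · qfac k · qfac d
qfac-split zero d = ≋-sym (≋-trans (⊗-cong (⊗-cong (subsetPoly-0 d) ≋-refl) ≋-refl) (⊗-identityˡ (qfac d)))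
qfac-split (suc k) zero = begin
  qfac (suc k ℕ.+ 0)                                 ≡⟨ cong qfac (ℕP.+-identityʳ (suc k)) ⟩
  qfac (suc k)                                       ≈⟨ pad (qfac (suc k)) ⟩
  oneL · qfac (suc k) · oneL                         ≈⟨ ⊗-cong (⊗-cong (≋-sym (subsetPoly-diag (suc k))) ≋-refl) ≋-refl ⟩
  subsetPoly (suc k) (suc k) · qfac (suc k) · oneL
    ≡⟨ cong (λ n → subsetPoly n (suc k) · qfac (suc k) · oneL) (ℕP.+-identityʳ (suc k)) ⟨
  subsetPoly (suc k ℕ.+ 0) (suc k) · qfac (suc k) · qfac 0 ∎
  where
  open SetoidReasoning ≋-setoid
  pad : ∀ p → p ≋ oneL · p · oneL
  pad = solve 1 (λ p → p := con 1ℤ :* p :* con 1ℤ) ≋-refl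
-- 1 - q^(k+d+2) = (1 - q^(d+1)) + q^(d+1) (1 - q^(k+1)), and each summand completes one induction
-- hypothesis.
qfac-split (suc k) (suc d) = begin
  F · oneMinusQ^ (+ suc N)                          ≈⟨ ⊗-congʳ F (1-‿cong (q^-cong (cong +_ (ℕP.+-comm (suc k) (suc d))))) ⟩
  F · 1- (X₂ · X₁)                                  ≈⟨ pascal F X₁ X₂ ⟩
  F · 1- X₂ ++ X₂ · (F · 1- X₁)                     ≈⟨ ++-cong (⊗-cong IH₁ ≋-refl) (⊗-congʳ X₂ (⊗-cong IH₂ ≋-refl)) ⟩
  G₁ · (a · 1- X₁) · b · 1- X₂ ++ X₂ · (G₀ · a · (b · 1- X₂) · 1- X₁)
                                                    ≈⟨ collect G₁ G₀ a b X₁ X₂ ⟩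
  (G₁ ++ X₂ · G₀) · (a · 1- X₁) · (b · 1- X₂)       ≈⟨ ⊗-cong (⊗-cong (≋-sym (subsetPoly-suc k (suc d))) ≋-refl) ≋-refl ⟩
  subsetPoly (suc N) (suc k) · qfac (suc k) · qfac (suc d) ∎
  where
  open SetoidReasoning ≋-setoid
  N = k ℕ.+ suc d
  F = qfac N
  G₁ = subsetPoly N (suc k)
  G₀ = subsetPoly N k
  a = qfac k
  b = qfac d
  X₁ = q^ (+ suc k)
  X₂ = q^ (+ suc d)
  IH₁ : F ≋ G₁ · qfac (suc k) · b
  IH₁ = subst (λ n → qfac n ≋ subsetPoly n (suc k) · qfac (suc k) · b) (sym (ℕP.+-suc k d)) (qfac-split (suc k) d)
  IH₂ : F ≋ G₀ · a · qfac (suc d)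
  IH₂ = qfac-split k (suc d)
  pascal : ∀ F X Y → F · 1- (Y · X) ≋ F · 1- Y ++ Y · (F · 1- X)
  pascal = solve 3 (λ F X Y → F :* (con 1ℤ :- Y :* X) := F :* (con 1ℤ :- Y) :+ Y :* (F :* (con 1ℤ :- X))) ≋-refl
  collect : ∀ G₁ G₀ a b X Y →
    G₁ · (a · 1- X) · b · 1- Y ++ Y · (G₀ · a · (b · 1- Y) · 1- X) ≋ (G₁ ++ Y · G₀) · (a · 1- X) · (b · 1- Y)
  collect = solve 6 (λ G₁ G₀ a b X Y →
      G₁ :* (a :* (con 1ℤ :- X)) :* b :* (con 1ℤ :- Y) :+ Y :* (G₀ :* a :* (b :* (con 1ℤ :- Y)) :* (con 1ℤ :- X))
    := (G₁ :+ Y :* G₀) :* (a :* (con 1ℤ :- X)) :* (b :* (con 1ℤ :- Y))) ≋-refl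

unit-split : ∀ {H} p → H ≋ oneL → p ≋ oneL · H · p · oneL
unit-split p H≋1 = ≋-trans (pad p) (⊗-cong (⊗-cong (⊗-congʳ oneL (≋-sym H≋1)) ≋-refl) ≋-refl)
  where
  pad : ∀ p → p ≋ oneL · oneL · p · oneL
  pad = solve 1 (λ p → p := con 1ℤ :* con 1ℤ :* p :* con 1ℤ) ≋-refl

1-‿factor : ∀ F Z X → F · 1- Z ≋ F · 1- (Z · X) ++ - (Z · (F · 1- X)) L
1-‿factor = solve 3 (λ F Z X →
  F :* (con 1ℤ :- Z) := F :* (con 1ℤ :- Z :* X) :+ :- (Z :* (F :* (con 1ℤ :- X)))) ≋-refl

qfac⁻-suc-split : ∀ k E H → qfac⁻ k ≋ E · H · oneL · qfac k →
  qfac⁻ (suc k) ≋ - E L · (q^ -[1+ k ] · H) · oneL · qfac (suc k)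
-- 1 - q^-(k+1) = -q^-(k+1) (1 - q^(k+1)).
qfac⁻-suc-split k E H IH = begin
  F · 1- Z                                        ≈⟨ 1-‿factor F Z X ⟩
  F · 1- (Z · X) ++ - (Z · (F · 1- X)) L
    ≈⟨ ++-cong (⊗-congʳ F (1-‿cong (q^-cong (ℤP.+-inverseˡ (+ suc k))))) (-L-cong (⊗-congʳ Z (⊗-cong IH ≋-refl))) ⟩
  F · 1- oneL ++ - (Z · (E · H · oneL · b · 1- X)) L ≈⟨ collect F E H b Z X ⟩
  - E L · (Z · H) · oneL · (b · 1- X)             ∎
  where
  open SetoidReasoning ≋-setoid
  F = qfac⁻ k
  Z = q^ -[1+ k ]
  X = q^ (+ suc k)
  b = qfac k
  collect : ∀ F E H b Z X →
    F · 1- oneL ++ - (Z · (E · H · oneL · b · 1- X)) L ≋ - E L · (Z · H) · oneL · (b · 1- X)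
  collect = solve 6 (λ F E H b Z X →
      F :* (con 1ℤ :- con 1ℤ) :+ :- (Z :* (E :* H :* con 1ℤ :* b :* (con 1ℤ :- X)))
    := :- E :* (Z :* H) :* con 1ℤ :* (b :* (con 1ℤ :- X))) ≋-refl

qfac⁻-split-multisets : ∀ m k → qfac⁻ (m ℕ.+ k) ≋ sign k · multisetPoly (suc m) k · qfac⁻ m · qfac k
qfac⁻-split-multisets m zero = subst (λ n → qfac⁻ n ≋ oneL · multisetPoly (suc m) 0 · qfac⁻ m · oneL)
  (sym (ℕP.+-identityʳ m)) (unit-split (qfac⁻ m) (multisetPoly-0 (suc m)))
qfac⁻-split-multisets zero (suc k) =
  ≋-trans (qfac⁻-suc-split k (sign k) (multisetPoly 1 k) (qfac⁻-split-multisets zero k))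
          (⊗-cong (⊗-cong (⊗-congʳ (- sign k L) (≋-sym (multisetPoly-suc 0 k))) ≋-refl) ≋-refl)
-- 1 - Z = (1 - Y₁) - Z (1 - X₁) because Z X₁ = Y₁.
qfac⁻-split-multisets (suc m) (suc k) = begin
  F · 1- Z                                        ≈⟨ 1-‿factor F Z X₁ ⟩
  F · 1- (Z · X₁) ++ - (Z · (F · 1- X₁)) L
    ≈⟨ ++-cong (⊗-cong IH₁ (1-‿cong (q^-cong shift))) (-L-cong (⊗-congʳ Z (⊗-cong IH₂ ≋-refl))) ⟩
  - E L · H₁ · a · (b · 1- X₁) · 1- Y₁ ++ - (Z · (E · H₂ · (a · 1- Y₁) · b · 1- X₁)) L
    ≈⟨ collect E H₁ H₂ a b Z X₁ Y₁ ⟩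
  - E L · (H₁ ++ Z · H₂) · (a · 1- Y₁) · (b · 1- X₁)
    ≈⟨ ⊗-cong (⊗-cong (⊗-congʳ (- E L) (≋-sym recurrence)) ≋-refl) ≋-refl ⟩
  sign (suc k) · multisetPoly (suc (suc m)) (suc k) · qfac⁻ (suc m) · qfac (suc k) ∎
  where
  open SetoidReasoning ≋-setoid
  F = qfac⁻ (m ℕ.+ suc k)
  Z = q^ -[1+ m ℕ.+ suc k ]
  X₁ = q^ (+ suc k)
  Y₁ = q^ -[1+ m ]
  E = sign k
  H₁ = multisetPoly (suc m) (suc k)
  H₂ = multisetPoly (suc (suc m)) k
  a = qfac⁻ m
  b = qfac k
  IH₁ : F ≋ - E L · H₁ · a · (b · 1- X₁)
  IH₁ = qfac⁻-split-multisets m (suc k)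
  IH₂ : F ≋ E · H₂ · (a · 1- Y₁) · b
  IH₂ = subst (λ n → qfac⁻ n ≋ E · H₂ · qfac⁻ (suc m) · b) (sym (ℕP.+-suc m k)) (qfac⁻-split-multisets (suc m) k)
  cancel : ∀ x y → x - y + y ≡ x
  cancel = solve-∀
  shift : -[1+ m ℕ.+ suc k ] + + suc k ≡ -[1+ m ]
  shift = trans (cong (_+ + suc k) (sym (trans (ℤP.neg-minus-pos m (suc k)) (cong -[1+_] (ℕP.+-comm (suc k) m)))))
                (cancel -[1+ m ] (+ suc k))
  recurrence : multisetPoly (suc (suc m)) (suc k) ≋ H₁ ++ Z · H₂
  recurrence = ≋-trans (multisetPoly-suc (suc m) k)
    (++-cong (≋-refl {H₁}) (⊗-cong (q^-cong (cong -[1+_] (sym (ℕP.+-suc m k)))) ≋-refl))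
  collect : ∀ E H₁ H₂ a b Z X Y →
    - E L · H₁ · a · (b · 1- X) · 1- Y ++ - (Z · (E · H₂ · (a · 1- Y) · b · 1- X)) L
      ≋ - E L · (H₁ ++ Z · H₂) · (a · 1- Y) · (b · 1- X)
  collect = solve 8 (λ E H₁ H₂ a b Z X Y →
      :- E :* H₁ :* a :* (b :* (con 1ℤ :- X)) :* (con 1ℤ :- Y)
        :+ :- (Z :* (E :* H₂ :* (a :* (con 1ℤ :- Y)) :* b :* (con 1ℤ :- X)))
    := :- E :* (H₁ :+ Z :* H₂) :* (a :* (con 1ℤ :- Y)) :* (b :* (con 1ℤ :- X))) ≋-refl

qfac⁻-split-complements : ∀ m t → qfac⁻ (m ℕ.+ t) ≋ sign t · complementPoly (suc m) t · qfac⁻ m · qfac t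
qfac⁻-split-complements m zero = subst (λ n → qfac⁻ n ≋ oneL · complementPoly (suc m) 0 · qfac⁻ m · oneL)
  (sym (ℕP.+-identityʳ m)) (unit-split (qfac⁻ m) (complementPoly-0 (suc m)))
qfac⁻-split-complements zero (suc t) =
  ≋-trans (qfac⁻-suc-split t (sign t) (complementPoly 1 t) (qfac⁻-split-complements zero t))
          (⊗-cong (⊗-cong (⊗-congʳ (- sign t L) (≋-sym (complementPoly-suc 0 t))) ≋-refl) ≋-refl)
-- 1 - W = Z X₁ - Z Y₁ because Z X₁ = 1 and Z Y₁ = W.
qfac⁻-split-complements (suc m) (suc t) = begin
  F · 1- W
    ≈⟨ ⊗-congʳ F (++-cong (≋-sym (q^-cong (ℤP.+-inverseˡ (+ suc t)))) (-L-cong (q^-cong shift))) ⟩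
  F · (Z · X₁ ++ - (Z · Y₁) L)                    ≈⟨ distribute F Z X₁ Y₁ ⟩
  Z · (F · 1- Y₁) ++ - (Z · (F · 1- X₁)) L
    ≈⟨ ++-cong (⊗-congʳ Z (⊗-cong IH₁ ≋-refl)) (-L-cong (⊗-congʳ Z (⊗-cong IH₂ ≋-refl))) ⟩
  Z · (- E L · H₁ · a · (b · 1- X₁) · 1- Y₁) ++ - (Z · (E · H₂ · (a · 1- Y₁) · b · 1- X₁)) L
    ≈⟨ collect E H₁ H₂ a b Z X₁ Y₁ ⟩
  - E L · (Z · (H₁ ++ H₂)) · (a · 1- Y₁) · (b · 1- X₁)
    ≈⟨ ⊗-cong (⊗-cong (⊗-congʳ (- E L) (≋-sym (complementPoly-suc (suc m) t))) ≋-refl) ≋-refl ⟩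
  sign (suc t) · complementPoly (suc (suc m)) (suc t) · qfac⁻ (suc m) · qfac (suc t) ∎
  where
  open SetoidReasoning ≋-setoid
  F = qfac⁻ (m ℕ.+ suc t)
  W = q^ -[1+ m ℕ.+ suc t ]
  Z = q^ -[1+ t ]
  X₁ = q^ (+ suc t)
  Y₁ = q^ -[1+ m ]
  E = sign t
  H₁ = complementPoly (suc m) (suc t)
  H₂ = complementPoly (suc (suc m)) t
  a = qfac⁻ m
  b = qfac t
  IH₁ : F ≋ - E L · H₁ · a · (b · 1- X₁)
  IH₁ = qfac⁻-split-complements m (suc t)
  IH₂ : F ≋ E · H₂ · (a · 1- Y₁) · b
  IH₂ = subst (λ n → qfac⁻ n ≋ E · H₂ · qfac⁻ (suc m) · b) (sym (ℕP.+-suc m t)) (qfac⁻-split-complements (suc m) t)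
  shift : -[1+ m ℕ.+ suc t ] ≡ -[1+ t ] + -[1+ m ]
  shift = cong -[1+_] (trans (ℕP.+-suc m t) (cong suc (ℕP.+-comm m t)))
  distribute : ∀ F Z X Y → F · (Z · X ++ - (Z · Y) L) ≋ Z · (F · 1- Y) ++ - (Z · (F · 1- X)) L
  distribute = solve 4 (λ F Z X Y →
    F :* (Z :* X :- Z :* Y) := Z :* (F :* (con 1ℤ :- Y)) :- Z :* (F :* (con 1ℤ :- X))) ≋-refl
  collect : ∀ E H₁ H₂ a b Z X Y →
    Z · (- E L · H₁ · a · (b · 1- X) · 1- Y) ++ - (Z · (E · H₂ · (a · 1- Y) · b · 1- X)) L
      ≋ - E L · (Z · (H₁ ++ H₂)) · (a · 1- Y) · (b · 1- X)
  collect = solve 8 (λ E H₁ H₂ a b Z X Y →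
      Z :* (:- E :* H₁ :* a :* (b :* (con 1ℤ :- X)) :* (con 1ℤ :- Y))
        :- Z :* (E :* H₂ :* (a :* (con 1ℤ :- Y)) :* b :* (con 1ℤ :- X))
    := :- E :* (Z :* (H₁ :+ H₂)) :* (a :* (con 1ℤ :- Y)) :* (b :* (con 1ℤ :- X))) ≋-refl

-- The limit a → q

ordAtQ-++ : ∀ F G → ordAtQ (F ++ G) ≡ ordAtQ F + ordAtQ G
ordAtQ-++ []            G = sym (ℤP.+-identityˡ _)
ordAtQ-++ ((j , m) ∷ F) G = trans (cong (_+_ x) (ordAtQ-++ F G)) (sym (ℤP.+-assoc x (ordAtQ F) (ordAtQ G)))
  where x = if does (j ℤ.≟ -1ℤ) then m else 0ℤ

numAtQ-++ : ∀ F G → numAtQ (F ++ G) ≋ numAtQ F · numAtQ G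
numAtQ-++ []                  G = ≋-sym (⊗-identityˡ (numAtQ G))
numAtQ-++ ((j , -[1+ c ]) ∷ F) G = numAtQ-++ F G
numAtQ-++ ((j , + c) ∷ F)    G with does (j ℤ.≟ -1ℤ)
... | true  = numAtQ-++ F G
... | false = ≋-trans (⊗-congʳ P (numAtQ-++ F G)) (≋-sym (⊗-assoc P (numAtQ F) (numAtQ G)))
  where P = oneMinusQ^ (j + 1ℤ) ^L c

denAtQ-++ : ∀ F G → denAtQ (F ++ G) ≋ denAtQ F · denAtQ G
denAtQ-++ []                  G = ≋-sym (⊗-identityˡ (denAtQ G))
denAtQ-++ ((j , + c) ∷ F)    G = denAtQ-++ F G
denAtQ-++ ((j , -[1+ c ]) ∷ F) G with does (j ℤ.≟ -1ℤ)
... | true  = denAtQ-++ F G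
... | false = ≋-trans (⊗-congʳ P (denAtQ-++ F G)) (≋-sym (⊗-assoc P (denAtQ F) (denAtQ G)))
  where P = oneMinusQ^ (j + 1ℤ) ^L suc c

ordAtQ-invF : ∀ F → ordAtQ (invF F) ≡ - ordAtQ F
ordAtQ-invF []            = refl
ordAtQ-invF ((j , m) ∷ F) with does (j ℤ.≟ -1ℤ)
... | true  = trans (cong (_+_ (- m)) (ordAtQ-invF F)) (sym (ℤP.neg-distrib-+ m (ordAtQ F)))
... | false = trans (ℤP.+-identityˡ _) (trans (ordAtQ-invF F) (cong -_ (sym (ℤP.+-identityˡ _))))

numAtQ-invF : ∀ F → numAtQ (invF F) ≋ denAtQ F
numAtQ-invF []                     = ≋-refl
numAtQ-invF ((j , + suc c) ∷ F)    = numAtQ-invF F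
numAtQ-invF ((j , + zero) ∷ F) with does (j ℤ.≟ -1ℤ)
... | true  = numAtQ-invF F
... | false = ≋-trans (⊗-identityˡ _) (numAtQ-invF F)
numAtQ-invF ((j , -[1+ c ]) ∷ F) with does (j ℤ.≟ -1ℤ)
... | true  = numAtQ-invF F
... | false = ⊗-congʳ (oneMinusQ^ (j + 1ℤ) ^L suc c) (numAtQ-invF F)

denAtQ-invF : ∀ F → denAtQ (invF F) ≋ numAtQ F
denAtQ-invF []                     = ≋-refl
denAtQ-invF ((j , -[1+ c ]) ∷ F)   = denAtQ-invF F
denAtQ-invF ((j , + zero) ∷ F) with does (j ℤ.≟ -1ℤ)
... | true  = denAtQ-invF F
... | false = ≋-trans (denAtQ-invF F) (≋-sym (⊗-identityˡ _))
denAtQ-invF ((j , + suc c) ∷ F) with does (j ℤ.≟ -1ℤ)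
... | true  = denAtQ-invF F
... | false = ⊗-congʳ (oneMinusQ^ (j + 1ℤ) ^L suc c) (denAtQ-invF F)

-- (a;q)_n = (1 - a/q)^(pochOrd n) · f(a) with f(q) = pochNum n / pochDen n.
pochOrd : ℤ → ℤ
pochOrd (+ n)    = 0ℤ
pochOrd -[1+ m ] = -1ℤ

pochNum : ℤ → LPoly
pochNum (+ n)    = qfac n
pochNum -[1+ m ] = oneL

pochDen : ℤ → LPoly
pochDen (+ n)    = oneL
pochDen -[1+ m ] = qfac⁻ m

single-factor : ∀ j → (oneMinusQ^ j ^L 1) ⊗ oneL ≋ oneMinusQ^ j
single-factor j = ≋-trans (⊗-identityʳ _) (⊗-identityʳ _)

ordAtQ-poch : ∀ n → ordAtQ (poch n) ≡ pochOrd n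
ordAtQ-poch (+ n) = pos n
  where
  pos : ∀ n → ordAtQ (pochPos n) ≡ 0ℤ
  pos zero    = refl
  pos (suc n) = trans (ordAtQ-++ (pochPos n) _) (cong (_+ 0ℤ) (pos n))
ordAtQ-poch -[1+ m ] = neg m
  where
  neg : ∀ m → ordAtQ (pochNeg (suc m)) ≡ -1ℤ
  neg zero    = refl
  neg (suc m) = trans (ordAtQ-++ (pochNeg (suc m)) _) (cong (_+ 0ℤ) (neg m))

numAtQ-poch : ∀ n → numAtQ (poch n) ≋ pochNum n
numAtQ-poch (+ n) = pos n
  where
  pos : ∀ n → numAtQ (pochPos n) ≋ qfac n
  pos zero    = ≋-refl
  pos (suc n) = ≋-trans (numAtQ-++ (pochPos n) _)
    (⊗-cong (pos n) (≋-trans (single-factor _) (≡⇒≋ (cong (λ i → oneMinusQ^ (+ i)) (ℕP.+-comm n 1)))))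
numAtQ-poch -[1+ m ] = neg (suc m)
  where
  neg : ∀ t → numAtQ (pochNeg t) ≋ oneL
  neg zero    = ≋-refl
  neg (suc t) = ≋-trans (numAtQ-++ (pochNeg t) _) (≋-trans (⊗-identityʳ _) (neg t))

denAtQ-poch : ∀ n → denAtQ (poch n) ≋ pochDen n
denAtQ-poch (+ n) = pos n
  where
  pos : ∀ n → denAtQ (pochPos n) ≋ oneL
  pos zero    = ≋-refl
  pos (suc n) = ≋-trans (denAtQ-++ (pochPos n) _) (≋-trans (⊗-identityʳ _) (pos n))
denAtQ-poch -[1+ m ] = neg m
  where
  neg : ∀ m → denAtQ (pochNeg (suc m)) ≋ qfac⁻ m
  neg zero    = ≋-refl
  neg (suc m) = ≋-trans (denAtQ-++ (pochNeg (suc m)) _) (⊗-cong (neg m) (single-factor _))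

ordAtQ-qbinomRatio : ∀ n k → ordAtQ (qbinomRatio n k) ≡ pochOrd n + (- pochOrd k + - pochOrd (n - k))
ordAtQ-qbinomRatio n k = trans (ordAtQ-++ (poch n) _)
  (cong₂ _+_ (ordAtQ-poch n) (trans (ordAtQ-++ (invF (poch k)) _) (cong₂ _+_ (inverted k) (inverted (n - k)))))
  where
  inverted : ∀ i → ordAtQ (invF (poch i)) ≡ - pochOrd i
  inverted i = trans (ordAtQ-invF (poch i)) (cong -_ (ordAtQ-poch i))

numAtQ-qbinomRatio : ∀ n k → numAtQ (qbinomRatio n k) ≋ pochNum n · (pochDen k · pochDen (n - k))
numAtQ-qbinomRatio n k = ≋-trans (numAtQ-++ (poch n) _)
  (⊗-cong (numAtQ-poch n) (≋-trans (numAtQ-++ (invF (poch k)) _) (⊗-cong (inverted k) (inverted (n - k)))))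
  where
  inverted : ∀ i → numAtQ (invF (poch i)) ≋ pochDen i
  inverted i = ≋-trans (numAtQ-invF (poch i)) (denAtQ-poch i)

denAtQ-qbinomRatio : ∀ n k → denAtQ (qbinomRatio n k) ≋ pochDen n · (pochNum k · pochNum (n - k))
denAtQ-qbinomRatio n k = ≋-trans (denAtQ-++ (poch n) _)
  (⊗-cong (denAtQ-poch n) (≋-trans (denAtQ-++ (invF (poch k)) _) (⊗-cong (inverted k) (inverted (n - k)))))
  where
  inverted : ∀ i → denAtQ (invF (poch i)) ≋ pochNum i
  inverted i = ≋-trans (denAtQ-invF (poch i)) (numAtQ-poch i)

qbinom-limit : ∀ n k d L → n - k ≡ d → pochOrd n + (- pochOrd k + - pochOrd d) ≡ 0ℤ →
  pochNum n · (pochDen k · pochDen d) ≋ L · (pochDen n · (pochNum k · pochNum d)) → QBinomIs n k L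
qbinom-limit n k _ L refl ord≡0 num≋L·den = inj₁ (trans (ordAtQ-qbinomRatio n k) ord≡0 , coeff-≡ num≋)
  where
  num≋ : numAtQ (qbinomRatio n k) ≋ L · denAtQ (qbinomRatio n k)
  num≋ = ≋-trans (numAtQ-qbinomRatio n k) (≋-trans num≋L·den (⊗-congʳ L (≋-sym (denAtQ-qbinomRatio n k))))

qbinom-vanishes : ∀ n k d → n - k ≡ d → pochOrd n + (- pochOrd k + - pochOrd d) ≡ 1ℤ → QBinomIs n k []
qbinom-vanishes n k _ refl ord≡1 =
  inj₂ (subst (0ℤ ℤ.<_) (sym (trans (ordAtQ-qbinomRatio n k) ord≡1)) (ℤ.+<+ (s≤s z≤n)) , λ _ → refl)

QBinomIs-cong : ∀ n k {L L′} → L ≋ L′ → QBinomIs n k L → QBinomIs n k L′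
QBinomIs-cong n k L≋L′ (inj₁ (ord , num)) = inj₁ (ord , λ e → trans (num e) (coeff-≡ (⊗-cong L≋L′ ≋-refl) e))
QBinomIs-cong n k L≋L′ (inj₂ (ord , L≈0)) = inj₂ (ord , λ e → trans (sym (coeff-≡ L≋L′ e)) (L≈0 e))

qbinom-subsets : ∀ K d → QBinomIs (+ (K ℕ.+ d)) (+ K) (subsetPoly (K ℕ.+ d) K)
qbinom-subsets K d = qbinom-limit (+ (K ℕ.+ d)) (+ K) (+ d) (subsetPoly (K ℕ.+ d) K) gap refl (begin
  qfac (K ℕ.+ d) · (oneL · oneL)                        ≈⟨ ⊗-identityʳ (qfac (K ℕ.+ d)) ⟩
  qfac (K ℕ.+ d)                                        ≈⟨ qfac-split K d ⟩
  subsetPoly (K ℕ.+ d) K · qfac K · qfac d              ≈⟨ reassoc (subsetPoly (K ℕ.+ d) K) (qfac K) (qfac d) ⟩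
  subsetPoly (K ℕ.+ d) K · (oneL · (qfac K · qfac d))   ∎)
  where
  open SetoidReasoning ≋-setoid
  cancel : ∀ k d → k + d - k ≡ d
  cancel = solve-∀
  gap : + (K ℕ.+ d) - + K ≡ + d
  gap = trans (cong (_- + K) (ℤP.pos-+ K d)) (cancel (+ K) (+ d))
  reassoc : ∀ S a b → S · a · b ≋ S · (oneL · (a · b))
  reassoc = solve 3 (λ S a b → S :* a :* b := S :* (con 1ℤ :* (a :* b))) ≋-refl

qbinom-multisets : ∀ m K → QBinomIs -[1+ m ] (+ K) (scaleL (-1ℤ ^ K) (multisetPoly (suc m) K))
qbinom-multisets m K = qbinom-limit -[1+ m ] (+ K) -[1+ K ℕ.+ m ] L (ℤP.neg-minus-pos m K) refl (begin
  oneL · (oneL · qfac⁻ (K ℕ.+ m))                    ≈⟨ ≋-trans (⊗-identityˡ _) (⊗-identityˡ _) ⟩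
  qfac⁻ (K ℕ.+ m)                                    ≡⟨ cong qfac⁻ (ℕP.+-comm K m) ⟩
  qfac⁻ (m ℕ.+ K)                                    ≈⟨ qfac⁻-split-multisets m K ⟩
  sign K · M · qfac⁻ m · qfac K                      ≈⟨ reassoc (sign K · M) (qfac⁻ m) (qfac K) ⟩
  sign K · M · (qfac⁻ m · (qfac K · oneL))           ≈⟨ ⊗-cong (sign-⊗ K M) ≋-refl ⟩
  L · (qfac⁻ m · (qfac K · oneL))                    ∎)
  where
  open SetoidReasoning ≋-setoid
  M = multisetPoly (suc m) K
  L = scaleL (-1ℤ ^ K) M
  reassoc : ∀ S a b → S · a · b ≋ S · (a · (b · oneL))
  reassoc = solve 3 (λ S a b → S :* a :* b := S :* (a :* (b :* con 1ℤ))) ≋-refl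

-[1+]-gap : ∀ m t → -[1+ m ] - -[1+ m ℕ.+ t ] ≡ + t
-[1+]-gap m t = trans (ℤP.[1+m]⊖[1+n]≡m⊖n (m ℕ.+ t) m) (trans (ℤP.⊖-≥ (ℕP.m≤m+n m t)) (cong +_ (ℕP.m+n∸m≡n m t)))

qbinom-complements : ∀ m t → QBinomIs -[1+ m ] -[1+ m ℕ.+ t ] (scaleL (-1ℤ ^ t) (complementPoly (suc m) t))
qbinom-complements m t = qbinom-limit -[1+ m ] -[1+ m ℕ.+ t ] (+ t) L (-[1+]-gap m t) refl (begin
  oneL · (qfac⁻ (m ℕ.+ t) · oneL)                    ≈⟨ ≋-trans (⊗-identityˡ _) (⊗-identityʳ _) ⟩
  qfac⁻ (m ℕ.+ t)                                    ≈⟨ qfac⁻-split-complements m t ⟩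
  sign t · C · qfac⁻ m · qfac t                      ≈⟨ reassoc (sign t · C) (qfac⁻ m) (qfac t) ⟩
  sign t · C · (qfac⁻ m · (oneL · qfac t))           ≈⟨ ⊗-cong (sign-⊗ t C) ≋-refl ⟩
  L · (qfac⁻ m · (oneL · qfac t))                    ∎)
  where
  open SetoidReasoning ≋-setoid
  C = complementPoly (suc m) t
  L = scaleL (-1ℤ ^ t) C
  reassoc : ∀ S a b → S · a · b ≋ S · (a · (oneL · b))
  reassoc = solve 3 (λ S a b → S :* a :* b := S :* (a :* (con 1ℤ :* b))) ≋-refl

qbinom-vanishes-above : ∀ {N K} → N ℕ.< K → QBinomIs (+ N) (+ K) []
qbinom-vanishes-above {N} {K} N<K = qbinom-vanishes (+ N) (+ K) -[1+ K ℕ.∸ suc N ]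
  (trans (ℤP.m-n≡m⊖n N K) (trans (ℤP.⊖-< N<K) (cong (λ n → - + n) (ℕP.+-∸-assoc 1 N<K)))) refl

qbinom-vanishes-negative : ∀ N K → QBinomIs (+ N) -[1+ K ] []
qbinom-vanishes-negative N K = qbinom-vanishes (+ N) -[1+ K ] (+ (N ℕ.+ suc K)) refl refl

qbinom-vanishes-between : ∀ {m j} → j ℕ.< m → QBinomIs -[1+ m ] -[1+ j ] []
qbinom-vanishes-between {m} {j} j<m = qbinom-vanishes -[1+ m ] -[1+ j ] -[1+ m ℕ.∸ suc j ]
  (trans (ℤP.[1+m]⊖[1+n]≡m⊖n j m) (trans (ℤP.⊖-< j<m) (cong (λ n → - + n) (ℕP.+-∸-assoc 1 j<m)))) refl

-- Enumerating vectors

Bits : ∀ {N} → Vec ℕ N → Set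
Bits = VecAll.All (ℕ._≤ 1)

multichoose-complete : ∀ {N} (l : Vec ℕ N) → l ∈ multichoose N (Vec.sum l)
multichoose-complete []          = here refl
multichoose-complete (zero ∷ l) with Vec.sum l | multichoose-complete l
... | zero  | l∈ = ∈-map⁺ (0 ∷_) l∈
... | suc _ | l∈ = ∈-++⁺ˡ (∈-map⁺ (0 ∷_) l∈)
multichoose-complete {suc N} (suc v ∷ l) =
  ∈-++⁺ʳ (map (0 ∷_) (multichoose N _)) (∈-map⁺ incrHead (multichoose-complete (v ∷ l)))

choose-complete : ∀ {N} (l : Vec ℕ N) → Bits l → l ∈ choose N (Vec.sum l)
choose-complete []          _ = here refl
choose-complete (zero ∷ l) (_ VecAll.∷ bits) with Vec.sum l | choose-complete l bits
... | zero  | l∈ = ∈-map⁺ (0 ∷_) l∈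
... | suc _ | l∈ = ∈-++⁺ˡ (∈-map⁺ (0 ∷_) l∈)
choose-complete {suc N} (suc zero ∷ l) (_ VecAll.∷ bits) =
  ∈-++⁺ʳ (map (0 ∷_) (choose N _)) (∈-map⁺ (1 ∷_) (choose-complete l bits))
choose-complete (suc (suc v) ∷ l) (s≤s () VecAll.∷ _)

multichoose-sound : ∀ N k {l} → l ∈ multichoose N k → Vec.sum l ≡ k
multichoose-sound zero    zero    (here refl) = refl
multichoose-sound (suc N) zero    l∈ with ∈-map⁻ (0 ∷_) l∈
... | _ , l′∈ , refl = multichoose-sound N zero l′∈
multichoose-sound (suc N) (suc k) l∈ with ∈-++⁻ (map (0 ∷_) (multichoose N (suc k))) l∈
... | inj₁ l∈₀ with ∈-map⁻ (0 ∷_) l∈₀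
...   | _ , l′∈ , refl = multichoose-sound N (suc k) l′∈
multichoose-sound (suc N) (suc k) l∈ | inj₂ l∈₁ with ∈-map⁻ incrHead l∈₁
...   | v ∷ _ , l′∈ , refl = cong suc (multichoose-sound (suc N) k l′∈)

choose-sound : ∀ N k {l} → l ∈ choose N k → Bits l × Vec.sum l ≡ k
choose-sound zero    zero    (here refl) = VecAll.[] , refl
choose-sound (suc N) zero    l∈ with ∈-map⁻ (0 ∷_) l∈
... | _ , l′∈ , refl with choose-sound N zero l′∈
...   | bits , sum≡ = z≤n VecAll.∷ bits , sum≡
choose-sound (suc N) (suc k) l∈ with ∈-++⁻ (map (0 ∷_) (choose N (suc k))) l∈
... | inj₁ l∈₀ with ∈-map⁻ (0 ∷_) l∈₀
...   | _ , l′∈ , refl with choose-sound N (suc k) l′∈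
...     | bits , sum≡ = z≤n VecAll.∷ bits , sum≡
choose-sound (suc N) (suc k) l∈ | inj₂ l∈₁ with ∈-map⁻ (1 ∷_) l∈₁
...   | _ , l′∈ , refl with choose-sound N k l′∈
...     | bits , sum≡ = s≤s z≤n VecAll.∷ bits , cong suc sum≡

map-distinct : ∀ {A B : Set} {f : A → B} → Injective _≡_ _≡_ f → ∀ {xs} → AllPairs _≢_ xs → AllPairs _≢_ (map f xs)
map-distinct f-inj distinct = AllPairs.map⁺ (AllPairs.map (λ x≢y fx≡fy → x≢y (f-inj fx≡fy)) distinct)

zero-head-apart : ∀ {M N} (f : Vec ℕ M → Vec ℕ (suc N)) → (∀ z → Vec.head (f z) ≢ 0) →
  ∀ xs zs → All (λ x → All (x ≢_) (map f zs)) (map (0 ∷_) xs)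
zero-head-apart f head≢0 xs zs =
  All.map⁺ (All.tabulate λ _ → All.map⁺ (All.tabulate λ {z} _ eq → head≢0 z (cong Vec.head (sym eq))))

∷-injective : ∀ {N} v → Injective _≡_ _≡_ (λ (l : Vec ℕ N) → v ∷ l)
∷-injective v refl = refl

incrHead-injective : ∀ {N} → Injective _≡_ _≡_ (incrHead {N})
incrHead-injective {x = _ ∷ _} {_ ∷ _} refl = refl

multichoose-distinct : ∀ N k → AllPairs _≢_ (multichoose N k)
multichoose-distinct zero    zero    = All.[] ∷ []
multichoose-distinct zero    (suc k) = []
multichoose-distinct (suc N) zero    = map-distinct (∷-injective 0) (multichoose-distinct N zero)
multichoose-distinct (suc N) (suc k) = AllPairs.++⁺
  (map-distinct (∷-injective 0) (multichoose-distinct N (suc k)))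
  (map-distinct incrHead-injective (multichoose-distinct (suc N) k))
  (zero-head-apart incrHead (λ { (_ ∷ _) () }) (multichoose N (suc k)) (multichoose (suc N) k))

choose-distinct : ∀ N k → AllPairs _≢_ (choose N k)
choose-distinct zero    zero    = All.[] ∷ []
choose-distinct zero    (suc k) = []
choose-distinct (suc N) zero    = map-distinct (∷-injective 0) (choose-distinct N zero)
choose-distinct (suc N) (suc k) = AllPairs.++⁺
  (map-distinct (∷-injective 0) (choose-distinct N (suc k)))
  (map-distinct (∷-injective 1) (choose-distinct N k))
  (zero-head-apart (1 ∷_) (λ _ ()) (choose N (suc k)) (choose N k))

-- Hybrid sets given by vectors

∣∣<⇒≢ : ∀ {w u} → ∣ w ∣ ℕ.< ∣ u ∣ → w ≢ u
∣∣<⇒≢ lt refl = ℕP.<-irrefl refl lt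

symSum-cong : ∀ B {f g : ℤ → ℤ} → (∀ u → f u ≡ g u) → symSum B f ≡ symSum B g
symSum-cong zero    f≗g = f≗g 0ℤ
symSum-cong (suc B) f≗g = cong₂ _+_ (cong₂ _+_ (f≗g _) (f≗g _)) (symSum-cong B f≗g)

symSum-+ : ∀ B f g → symSum B (λ u → f u + g u) ≡ symSum B f + symSum B g
symSum-+ zero    f g = refl
symSum-+ (suc B) f g = trans (cong (_+_ (f (+ suc B) + g (+ suc B) + (f -[1+ B ] + g -[1+ B ]))) (symSum-+ B f g))
  (regroup (f (+ suc B)) (g (+ suc B)) (f -[1+ B ]) (g -[1+ B ]) (symSum B f) (symSum B g))
  where
  regroup : ∀ a b c d x y → a + b + (c + d) + (x + y) ≡ a + c + x + (b + d + y)
  regroup = solve-∀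

symSum-0 : ∀ B f → (∀ u → ∣ u ∣ ℕ.≤ B → f u ≡ 0ℤ) → symSum B f ≡ 0ℤ
symSum-0 zero    f f≡0 = f≡0 0ℤ z≤n
symSum-0 (suc B) f f≡0 = cong₂ _+_ (cong₂ _+_ (f≡0 _ ℕP.≤-refl) (f≡0 _ ℕP.≤-refl))
  (symSum-0 B f λ u ∣u∣≤B → f≡0 u (ℕP.m≤n⇒m≤1+n ∣u∣≤B))

symSum-point : ∀ B w c → ∣ w ∣ ℕ.≤ B → symSum B (λ u → [ w ≟ u ] c) ≡ c
symSum-point zero    (+ zero) c _ = refl
symSum-point (suc B) w c ∣w∣≤1+B with ℕP.m≤n⇒m<n∨m≡n ∣w∣≤1+B
... | inj₁ ∣w∣≤B = begin
  [ w ≟ + suc B ] c + [ w ≟ -[1+ B ] ] c + symSum B δ   ≡⟨ cong₂ (λ x y → x + y + symSum B δ) (miss (+ suc B) refl) (miss -[1+ B ] refl) ⟩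
  0ℤ + symSum B δ                                       ≡⟨ ℤP.+-identityˡ _ ⟩
  symSum B δ                                            ≡⟨ symSum-point B w c (ℕP.≤-pred ∣w∣≤B) ⟩
  c                                                     ∎
  where
  open ≡-Reasoning
  δ = λ u → [ w ≟ u ] c
  miss : ∀ u → ∣ u ∣ ≡ suc B → [ w ≟ u ] c ≡ 0ℤ
  miss u ∣u∣≡1+B = [≟]-no {w} {u} c (∣∣<⇒≢ (subst (∣ w ∣ ℕ.<_) (sym ∣u∣≡1+B) ∣w∣≤B))
... | inj₂ ∣w∣≡1+B = begin
  [ w ≟ + suc B ] c + [ w ≟ -[1+ B ] ] c + symSum B δ   ≡⟨ cong (_+_ ([ w ≟ + suc B ] c + [ w ≟ -[1+ B ] ] c)) inner ⟩
  [ w ≟ + suc B ] c + [ w ≟ -[1+ B ] ] c + 0ℤ          ≡⟨ on-boundary w ∣w∣≡1+B ⟩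
  c                                                     ∎
  where
  open ≡-Reasoning
  δ = λ u → [ w ≟ u ] c
  inner : symSum B δ ≡ 0ℤ
  inner = symSum-0 B δ λ u ∣u∣≤B →
    [≟]-no {w} {u} c (≢-sym (∣∣<⇒≢ (subst (∣ u ∣ ℕ.<_) (sym ∣w∣≡1+B) (s≤s ∣u∣≤B))))
  on-boundary : ∀ w → ∣ w ∣ ≡ suc B → [ w ≟ + suc B ] c + [ w ≟ -[1+ B ] ] c + 0ℤ ≡ c
  on-boundary (+ _)    refl =
    trans (cong (λ x → x + 0ℤ + 0ℤ) ([≟]-yes (+ suc B) c)) (trans (ℤP.+-identityʳ _) (ℤP.+-identityʳ c))
  on-boundary -[1+ _ ] refl =
    trans (cong (λ x → 0ℤ + x + 0ℤ) ([≟]-yes -[1+ B ] c)) (trans (ℤP.+-identityʳ _) (ℤP.+-identityˡ c))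

symSum-extend : ∀ B f → (∀ u → B ℕ.< ∣ u ∣ → f u ≡ 0ℤ) → ∀ d → symSum (d ℕ.+ B) f ≡ symSum B f
symSum-extend B f f≡0 zero    = refl
symSum-extend B f f≡0 (suc d) =
  trans (cong₂ (λ x y → x + y + symSum (d ℕ.+ B) f) (f≡0 _ beyond) (f≡0 _ beyond))
        (trans (ℤP.+-identityˡ _) (symSum-extend B f f≡0 d))
  where
  beyond : B ℕ.< suc (d ℕ.+ B)
  beyond = s≤s (ℕP.m≤n+m B d)

symSum-bound-irrelevant : ∀ B B′ f → (∀ u → B ℕ.< ∣ u ∣ → f u ≡ 0ℤ) → (∀ u → B′ ℕ.< ∣ u ∣ → f u ≡ 0ℤ) →
  symSum B f ≡ symSum B′ f
symSum-bound-irrelevant B B′ f f≡0 f≡0′ = begin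
  symSum B f             ≡⟨ symSum-extend B f f≡0 B′ ⟨
  symSum (B′ ℕ.+ B) f    ≡⟨ cong (λ b → symSum b f) (ℕP.+-comm B′ B) ⟩
  symSum (B ℕ.+ B′) f    ≡⟨ symSum-extend B′ f f≡0′ B ⟩
  symSum B′ f            ∎
  where open ≡-Reasoning

card-≐ : ∀ X Y → X ≐ Y → card X ≡ card Y
card-≐ X Y X≐Y = trans (symSum-cong (bound X) X≐Y)
  (symSum-bound-irrelevant (bound X) (bound Y) (mult Y) (λ u far → trans (sym (X≐Y u)) (supp X u far)) (supp Y))

card-transport : ∀ Y Z {c k} → Y ≐ Z → card Z ≡ c → card Y ≡ k → c ≡ k
card-transport Y Z Y≐Z cardZ cardY = trans (sym cardZ) (trans (sym (card-≐ Y Z Y≐Z)) cardY)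

sumℤ : ∀ {N} → Vec ℤ N → ℤ
sumℤ []      = 0ℤ
sumℤ (v ∷ l) = v + sumℤ l

module Window (pos : ℕ → ℤ) (pos-bound : ∀ i → ∣ pos i ∣ ℕ.≤ suc i)
              (pos-injective : ∀ {i j} → pos i ≡ pos j → i ≡ j) where

  vecMult : ∀ {N} → Vec ℤ N → ℤ → ℤ
  vecMult []              u = 0ℤ
  vecMult {suc N} (v ∷ l) u = [ pos N ≟ u ] v + vecMult l u

  vecMult-support : ∀ {N} (l : Vec ℤ N) u → N ℕ.< ∣ u ∣ → vecMult l u ≡ 0ℤ
  vecMult-support []              u _       = refl
  vecMult-support {suc N} (v ∷ l) u N<∣u∣ =
    trans (cong₂ _+_ ([≟]-no {pos N} {u} v (∣∣<⇒≢ (ℕP.≤-<-trans (pos-bound N) N<∣u∣)))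
                     (vecMult-support l u (ℕP.<-trans (ℕP.n<1+n N) N<∣u∣)))
          (ℤP.+-identityˡ _)

  toHSet : ∀ {N} → Vec ℤ N → HSet
  toHSet {N} l = record { mult = vecMult l ; bound = N ; supp = vecMult-support l }

  symSum-vecMult : ∀ {N} (l : Vec ℤ N) B → N ℕ.≤ B → symSum B (vecMult l) ≡ sumℤ l
  symSum-vecMult []              B _   = symSum-0 B _ λ _ _ → refl
  symSum-vecMult {suc N} (v ∷ l) B N<B = trans (symSum-+ B (λ u → [ pos N ≟ u ] v) (vecMult l))
    (cong₂ _+_ (symSum-point B (pos N) v (ℕP.≤-trans (pos-bound N) N<B)) (symSum-vecMult l B (ℕP.<⇒≤ N<B)))

  symSum-vecMult-moment : ∀ {N} (l : Vec ℤ N) B → N ℕ.≤ B → symSum B (λ u → vecMult l u * u) ≡ weight pos l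
  symSum-vecMult-moment []              B _   = symSum-0 B _ λ _ _ → refl
  symSum-vecMult-moment {suc N} (v ∷ l) B N<B = begin
    symSum B (λ u → vecMult (v ∷ l) u * u)
      ≡⟨ symSum-cong B (λ u → trans (ℤP.*-distribʳ-+ u ([ pos N ≟ u ] v) (vecMult l u))
                                    (cong (_+ vecMult l u * u) (point-moment u))) ⟩
    symSum B (λ u → [ pos N ≟ u ] (v * pos N) + vecMult l u * u)
      ≡⟨ symSum-+ B (λ u → [ pos N ≟ u ] (v * pos N)) (λ u → vecMult l u * u) ⟩
    symSum B (λ u → [ pos N ≟ u ] (v * pos N)) + symSum B (λ u → vecMult l u * u)
      ≡⟨ cong₂ _+_ (symSum-point B (pos N) (v * pos N) (ℕP.≤-trans (pos-bound N) N<B))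
                   (symSum-vecMult-moment l B (ℕP.<⇒≤ N<B)) ⟩
    v * pos N + weight pos l ∎
    where
    open ≡-Reasoning
    point-moment : ∀ u → [ pos N ≟ u ] v * u ≡ [ pos N ≟ u ] (v * pos N)
    point-moment u with pos N ℤ.≟ u
    ... | yes refl = refl
    ... | no _     = refl

  card-toHSet : ∀ {N} (l : Vec ℤ N) → card (toHSet l) ≡ sumℤ l
  card-toHSet {N} l = symSum-vecMult l N ℕP.≤-refl

  σ-toHSet : ∀ {N} (l : Vec ℤ N) → σ (toHSet l) ≡ weight pos l
  σ-toHSet {N} l = symSum-vecMult-moment l N ℕP.≤-refl

  inWindow : ℕ → ℤ → Bool
  inWindow zero    u = false
  inWindow (suc N) u = does (pos N ℤ.≟ u) ∨ inWindow N u

  readAt : ∀ {N} → Vec ℕ N → ℤ → ℕ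
  readAt []              u = 0
  readAt {suc N} (v ∷ l) u = if does (pos N ℤ.≟ u) then v else readAt l u

  window : (ℤ → ℕ) → (N : ℕ) → Vec ℕ N
  window s zero    = []
  window s (suc N) = s (pos N) ∷ window s N

  inWindow-beyond : ∀ N i → N ℕ.≤ i → inWindow N (pos i) ≡ false
  inWindow-beyond zero    i _   = refl
  inWindow-beyond (suc N) i N<i with pos N ℤ.≟ pos i
  ... | yes pN≡pi = contradiction (pos-injective pN≡pi) (ℕP.<⇒≢ N<i)
  ... | no _      = inWindow-beyond N i (ℕP.<⇒≤ N<i)

  inWindow⇒pos : ∀ N u → inWindow N u ≡ true → Σ ℕ λ i → i ℕ.< N × pos i ≡ u
  inWindow⇒pos (suc N) u inW with pos N ℤ.≟ u
  ... | yes pN≡u = N , ℕP.≤-refl , pN≡u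
  ... | no _ with inWindow⇒pos N u inW
  ...   | i , i<N , pi≡u = i , ℕP.m≤n⇒m≤1+n i<N , pi≡u

  pos⇒inWindow : ∀ N i → i ℕ.< N → inWindow N (pos i) ≡ true
  pos⇒inWindow (suc N) i i<1+N with pos N ℤ.≟ pos i
  ... | yes _ = refl
  ... | no pN≢pi with ℕP.m≤n⇒m<n∨m≡n i<1+N
  ...   | inj₁ (s≤s i<N) = pos⇒inWindow N i i<N
  ...   | inj₂ refl      = contradiction refl pN≢pi

  inWindow-far : ∀ N u → N ℕ.< ∣ u ∣ → inWindow N u ≡ false
  inWindow-far N u N<∣u∣ with inWindow N u in inW
  ... | false = refl
  ... | true with inWindow⇒pos N u inW
  ...   | i , i<N , refl = contradiction (ℕP.≤-trans (pos-bound i) i<N) (ℕP.<⇒≱ N<∣u∣)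

  vecMult-map : ∀ (g : ℕ → ℤ) {N} (l : Vec ℕ N) u →
    vecMult (Vec.map g l) u ≡ (if inWindow N u then g (readAt l u) else 0ℤ)
  vecMult-map g []              u = refl
  vecMult-map g {suc N} (v ∷ l) u with pos N ℤ.≟ u
  ... | yes refl = trans (cong (_+_ (g v)) (trans (vecMult-map g l (pos N))
                           (cong (λ b → if b then g (readAt l (pos N)) else 0ℤ) (inWindow-beyond N N ℕP.≤-refl))))
                         (ℤP.+-identityʳ (g v))
  ... | no _     = trans (ℤP.+-identityˡ _) (vecMult-map g l u)

  vecMult-inside : ∀ (g : ℕ → ℤ) {N} (l : Vec ℕ N) {u} → inWindow N u ≡ true → vecMult (Vec.map g l) u ≡ g (readAt l u)
  vecMult-inside g l {u} inW = trans (vecMult-map g l u) (cong (λ b → if b then g (readAt l u) else 0ℤ) inW)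

  vecMult-outside : ∀ (g : ℕ → ℤ) {N} (l : Vec ℕ N) {u} → inWindow N u ≡ false → vecMult (Vec.map g l) u ≡ 0ℤ
  vecMult-outside g l {u} out = trans (vecMult-map g l u) (cong (λ b → if b then g (readAt l u) else 0ℤ) out)

  readAt-window : ∀ s N {u} → inWindow N u ≡ true → readAt (window s N) u ≡ s u
  readAt-window s (suc N) {u} inW with pos N ℤ.≟ u
  ... | yes refl = refl
  ... | no _     = readAt-window s N inW

  readAt-outside : ∀ {N} (l : Vec ℕ N) {u} → inWindow N u ≡ false → readAt l u ≡ 0
  readAt-outside []              _   = refl
  readAt-outside {suc N} (v ∷ l) {u} out with pos N ℤ.≟ u
  ... | no _ = readAt-outside l out

  readAt-finite : ∀ {N} (l : Vec ℕ N) → Σ ℕ λ B → ∀ u → B ℕ.< ∣ u ∣ → readAt l u ≡ 0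
  readAt-finite {N} l = N , λ u far → readAt-outside l (inWindow-far N u far)

  readAt-bits : ∀ {N} (l : Vec ℕ N) u → Bits l → readAt l u ℕ.≤ 1
  readAt-bits []              u _                   = z≤n
  readAt-bits {suc N} (v ∷ l) u (v≤1 VecAll.∷ bits) with pos N ℤ.≟ u
  ... | yes _ = v≤1
  ... | no _  = readAt-bits l u bits

  window-bits : ∀ s N → (∀ u → inWindow N u ≡ true → s u ℕ.≤ 1) → Bits (window s N)
  window-bits s zero    _     = VecAll.[]
  window-bits s (suc N) s≤1 = s≤1 (pos N) (pos⇒inWindow (suc N) N ℕP.≤-refl)
    VecAll.∷ window-bits s N (λ u inW → s≤1 u (trans (cong (does (pos N ℤ.≟ u) ∨_) inW) (Bool.∨-zeroʳ _)))

  vecMult-window : ∀ (g : ℕ → ℤ) s N (f : ℤ → ℤ) →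
    (∀ u → inWindow N u ≡ true → f u ≡ g (s u)) → (∀ u → inWindow N u ≡ false → f u ≡ 0ℤ) →
    ∀ u → f u ≡ vecMult (Vec.map g (window s N)) u
  vecMult-window g s N f inside outside u with inWindow N u in inW
  ... | true  = trans (inside u inW) (sym (trans (vecMult-inside g (window s N) inW) (cong g (readAt-window s N inW))))
  ... | false = trans (outside u inW) (sym (vecMult-outside g (window s N) inW))

  vecMult-readAt : ∀ (g : ℕ → ℤ) {N} (l : Vec ℕ N) u → g 0 ≡ 0ℤ → vecMult (Vec.map g l) u ≡ g (readAt l u)
  vecMult-readAt g {N} l u g0≡0 with inWindow N u in inW
  ... | true  = vecMult-inside g l inW
  ... | false = trans (vecMult-outside g l inW) (trans (sym g0≡0) (cong g (sym (readAt-outside l inW))))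

  toHSet-injective : ∀ {g : ℕ → ℤ} → Injective _≡_ _≡_ g → ∀ {N} (a b : Vec ℕ N) →
    toHSet (Vec.map g a) ≐ toHSet (Vec.map g b) → a ≡ b
  toHSet-injective g-inj []      []      _    = refl
  toHSet-injective {g} g-inj {suc N} (v ∷ a) (w ∷ b) a≐b = cong₂ _∷_ v≡w (toHSet-injective g-inj a b tail≐)
    where
    at-top : ∀ x (c : Vec ℕ N) → vecMult (Vec.map g (x ∷ c)) (pos N) ≡ g x
    at-top x c = trans (cong₂ _+_ ([≟]-yes (pos N) (g x)) (vecMult-outside g c (inWindow-beyond N N ℕP.≤-refl)))
                       (ℤP.+-identityʳ (g x))
    v≡w : v ≡ w
    v≡w = g-inj (trans (sym (at-top v a)) (trans (a≐b (pos N)) (at-top w b)))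
    tail≐ : toHSet (Vec.map g a) ≐ toHSet (Vec.map g b)
    tail≐ u = ∙-cancelˡ ([ pos N ≟ u ] (g v)) _ _ (trans (a≐b u) (cong (λ x → [ pos N ≟ u ] (g x) + _) (sym v≡w)))

-- The k-subsets of the standard new sets

module Nonneg = Window +_ ℕP.n≤1+n ℤP.+-injective
module Neg    = Window -[1+_] (λ _ → ℕP.≤-refl) ℤP.-[1+-injective

multX-inside⁺ : ∀ N {u} → Nonneg.inWindow N u ≡ true → multX (+ N) u ≡ 1ℤ
multX-inside⁺ N {u} inW with Nonneg.inWindow⇒pos N u inW
... | x , x<N , refl with x ℕ.<ᵇ N in x<ᵇN
...   | true  = refl
...   | false = ⊥-elim (subst T x<ᵇN (ℕP.<⇒<ᵇ x<N))

multX-outside⁺ : ∀ N {u} → Nonneg.inWindow N u ≡ false → multX (+ N) u ≡ 0ℤ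
multX-outside⁺ N { -[1+ x ]} _ = refl
multX-outside⁺ N {+ x} out with x ℕ.<ᵇ N in x<ᵇN
... | false = refl
... | true  = contradiction (trans (sym (Nonneg.pos⇒inWindow N x (ℕP.<ᵇ⇒< x N (subst T (sym x<ᵇN) _)))) out) λ ()

multX-inside⁻ : ∀ m {u} → Neg.inWindow (suc m) u ≡ true → multX -[1+ m ] u ≡ -1ℤ
multX-inside⁻ m {u} inW with Neg.inWindow⇒pos (suc m) u inW
... | x , s≤s x≤m , refl with x ℕ.≤ᵇ m in x≤ᵇm
...   | true  = refl
...   | false = ⊥-elim (subst T x≤ᵇm (ℕP.≤⇒≤ᵇ x≤m))

multX-outside⁻ : ∀ m {u} → Neg.inWindow (suc m) u ≡ false → multX -[1+ m ] u ≡ 0ℤ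
multX-outside⁻ m {+ x} _ = refl
multX-outside⁻ m { -[1+ x ]} out with x ℕ.≤ᵇ m in x≤ᵇm
... | false = refl
... | true  = contradiction (trans (sym (Neg.pos⇒inWindow (suc m) x x<1+m)) out) λ ()
  where
  x<1+m = s≤s (ℕP.≤ᵇ⇒≤ x m (subst T (sym x≤ᵇm) _))

-- The subset of X_N chosen by a 0/1-vector, and for a vector r on the points of X_{-(m+1)} the
-- removed multiset r and the remainder X_{-(m+1)} - r, of multiplicity -1 - r_i.
bitsSet : ∀ {N} → Vec ℕ N → HSet
bitsSet l = Nonneg.toHSet (Vec.map +_ l)

multisetSet : ∀ {N} → Vec ℕ N → HSet
multisetSet l = Neg.toHSet (Vec.map +_ l)

complementSet : ∀ {N} → Vec ℕ N → HSet
complementSet l = Neg.toHSet (Vec.map -[1+_] l)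

sumℤ-+ : ∀ {N} (l : Vec ℕ N) → sumℤ (Vec.map +_ l) ≡ + Vec.sum l
sumℤ-+ []      = refl
sumℤ-+ (v ∷ l) = trans (cong (_+_ (+ v)) (sumℤ-+ l)) (sym (ℤP.pos-+ v (Vec.sum l)))

sumℤ-[1+] : ∀ {N} (l : Vec ℕ N) → sumℤ (Vec.map -[1+_] l) ≡ - + (N ℕ.+ Vec.sum l)
sumℤ-[1+] []              = refl
sumℤ-[1+] {suc N} (v ∷ l) = begin
  -[1+ v ] + sumℤ (Vec.map -[1+_] l)
    ≡⟨ cong₂ _+_ (cong -_ (ℤP.pos-+ 1 v)) (trans (sumℤ-[1+] l) (cong -_ (ℤP.pos-+ N (Vec.sum l)))) ⟩
  - (1ℤ + + v) + - (+ N + + Vec.sum l)        ≡⟨ regroup (+ v) (+ N) (+ Vec.sum l) ⟩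
  - (1ℤ + + N + (+ v + + Vec.sum l))          ≡⟨ cong -_ (cong₂ _+_ (ℤP.pos-+ 1 N) (ℤP.pos-+ v (Vec.sum l))) ⟨
  - (+ suc N + + (v ℕ.+ Vec.sum l))           ≡⟨ cong -_ (ℤP.pos-+ (suc N) (v ℕ.+ Vec.sum l)) ⟨
  - + (suc N ℕ.+ Vec.sum (v ∷ l))             ∎
  where
  open ≡-Reasoning
  regroup : ∀ v n s → - (1ℤ + v) + - (n + s) ≡ - (1ℤ + n + (v + s))
  regroup = solve-∀

card-bitsSet : ∀ {N} (l : Vec ℕ N) → card (bitsSet l) ≡ + Vec.sum l
card-bitsSet l = trans (Nonneg.card-toHSet (Vec.map +_ l)) (sumℤ-+ l)

card-multisetSet : ∀ {N} (l : Vec ℕ N) → card (multisetSet l) ≡ + Vec.sum l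
card-multisetSet l = trans (Neg.card-toHSet (Vec.map +_ l)) (sumℤ-+ l)

card-complementSet : ∀ {N} (l : Vec ℕ N) → card (complementSet l) ≡ - + (N ℕ.+ Vec.sum l)
card-complementSet l = trans (Neg.card-toHSet (Vec.map -[1+_] l)) (sumℤ-[1+] l)

removable-bound : ∀ {M n r} → M ≡ + n → (0ℤ ℤ.≤ M → + r ℤ.≤ M) → r ℕ.≤ n
removable-bound M≡n r≤M = ℤP.drop‿+≤+ (subst (_ ℤ.≤_) M≡n (r≤M (subst (0ℤ ℤ.≤_) (sym M≡n) (ℤ.+≤+ z≤n))))

-1-minus : ∀ n → -1ℤ - + n ≡ -[1+ n ]
-1-minus n = trans (ℤP.neg-minus-pos 0 n) (cong -[1+_] (ℕP.+-identityʳ n))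

subsets-of-nonneg : ∀ N Y → IsSubsetOf Y (stdX (+ N)) → Σ (Vec ℕ N) λ l → Bits l × Y ≐ bitsSet l
subsets-of-nonneg N Y (r , _ , r≤M , removal) = case removal
  where
  open Nonneg
  r≤1 : ∀ u → inWindow N u ≡ true → r u ℕ.≤ 1
  r≤1 u inW = removable-bound (multX-inside⁺ N inW) (r≤M u)
  r≡0 : ∀ u → inWindow N u ≡ false → r u ≡ 0
  r≡0 u out = ℕP.n≤0⇒n≡0 (removable-bound (multX-outside⁺ N out) (r≤M u))
  case : _ → Σ (Vec ℕ N) λ l → Bits l × Y ≐ bitsSet l
  case (inj₁ Y≡r)   = window r N , window-bits r N r≤1 ,
    vecMult-window +_ r N (mult Y) (λ u _ → Y≡r u) (λ u out → trans (Y≡r u) (cong +_ (r≡0 u out)))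
  case (inj₂ Y≡X-r) = window (λ u → 1 ℕ.∸ r u) N , window-bits _ N (λ u _ → ℕP.m∸n≤m 1 (r u)) ,
    vecMult-window +_ (λ u → 1 ℕ.∸ r u) N (mult Y)
      (λ u inW → trans (Y≡X-r u) (trans (cong (_- + r u) (multX-inside⁺ N inW))
                                         (trans (ℤP.m-n≡m⊖n 1 (r u)) (ℤP.⊖-≥ (r≤1 u inW)))))
      (λ u out → trans (Y≡X-r u) (cong₂ _-_ (multX-outside⁺ N out) (cong +_ (r≡0 u out))))

subsets-of-neg : ∀ m Y → IsSubsetOf Y (stdX -[1+ m ]) →
  Σ (Vec ℕ (suc m)) λ l → Y ≐ multisetSet l ⊎ Y ≐ complementSet l
subsets-of-neg m Y (r , _ , r≤M , removal) = window r (suc m) , case removal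
  where
  open Neg
  r≡0 : ∀ u → inWindow (suc m) u ≡ false → r u ≡ 0
  r≡0 u out = ℕP.n≤0⇒n≡0 (removable-bound (multX-outside⁻ m out) (r≤M u))
  case : _ → Y ≐ multisetSet (window r (suc m)) ⊎ Y ≐ complementSet (window r (suc m))
  case (inj₁ Y≡r)   = inj₁ (vecMult-window +_ r (suc m) (mult Y)
    (λ u _ → Y≡r u) (λ u out → trans (Y≡r u) (cong +_ (r≡0 u out))))
  case (inj₂ Y≡X-r) = inj₂ (vecMult-window -[1+_] r (suc m) (mult Y)
    (λ u inW → trans (Y≡X-r u) (trans (cong (_- + r u) (multX-inside⁻ m inW)) (-1-minus (r u))))
    (λ u out → trans (Y≡X-r u) (cong₂ _-_ (multX-outside⁻ m out) (cong +_ (r≡0 u out)))))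

bitsSet-subset : ∀ {N} (l : Vec ℕ N) → Bits l → IsSubsetOf (bitsSet l) (stdX (+ N))
bitsSet-subset {N} l bits = readAt l , readAt-finite l , removable , inj₁ (λ u → vecMult-readAt +_ l u refl)
  where
  open Nonneg
  removable : ∀ u → 0ℤ ℤ.≤ multX (+ N) u → + readAt l u ℤ.≤ multX (+ N) u
  removable u _ with inWindow N u in inW
  ... | true  = subst (+ readAt l u ℤ.≤_) (sym (multX-inside⁺ N inW)) (ℤ.+≤+ (readAt-bits l u bits))
  ... | false = subst₂ ℤ._≤_ (cong +_ (sym (readAt-outside l inW))) (sym (multX-outside⁺ N inW)) (ℤ.+≤+ z≤n)

removable⁻ : ∀ {m} (l : Vec ℕ (suc m)) u → 0ℤ ℤ.≤ multX -[1+ m ] u → + Neg.readAt l u ℤ.≤ multX -[1+ m ] u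
removable⁻ {m} l u 0≤X with Neg.inWindow (suc m) u in inW
... | true  = contradiction (subst (0ℤ ℤ.≤_) (multX-inside⁻ m inW) 0≤X) λ ()
... | false = subst₂ ℤ._≤_ (cong +_ (sym (Neg.readAt-outside l inW))) (sym (multX-outside⁻ m inW)) (ℤ.+≤+ z≤n)

multisetSet-subset : ∀ {m} (l : Vec ℕ (suc m)) → IsSubsetOf (multisetSet l) (stdX -[1+ m ])
multisetSet-subset l = Neg.readAt l , Neg.readAt-finite l , removable⁻ l , inj₁ (λ u → Neg.vecMult-readAt +_ l u refl)

complementSet-subset : ∀ {m} (l : Vec ℕ (suc m)) → IsSubsetOf (complementSet l) (stdX -[1+ m ])
complementSet-subset {m} l = readAt l , readAt-finite l , removable⁻ l , inj₂ complement
  where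
  open Neg
  complement : ∀ u → vecMult (Vec.map -[1+_] l) u ≡ multX -[1+ m ] u - + readAt l u
  complement u with inWindow (suc m) u in inW
  ... | true  = trans (vecMult-inside -[1+_] l inW)
    (sym (trans (cong (_- + readAt l u) (multX-inside⁻ m inW)) (-1-minus (readAt l u))))
  ... | false = trans (vecMult-outside -[1+_] l inW)
    (sym (cong₂ _-_ (multX-outside⁻ m inW) (cong +_ (readAt-outside l inW))))

IsKSubsetOf-≐ : ∀ {k X} Y Y′ → Y ≐ Y′ → IsKSubsetOf k Y′ X → IsKSubsetOf k Y X
IsKSubsetOf-≐ Y Y′ Y≐Y′ ((r , finite , r≤X , removal) , card≡k) =
  (r , finite , r≤X , Sum.map (λ Y′≡ u → trans (Y≐Y′ u) (Y′≡ u)) (λ Y′≡ u → trans (Y≐Y′ u) (Y′≡ u)) removal) ,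
  trans (card-≐ Y Y′ Y≐Y′) card≡k

Enumerates-intro : ∀ {A : Set} k X (F : A → HSet) (xs : List A) →
  (∀ {x} → x ∈ xs → IsKSubsetOf k (F x) X) →
  (∀ Y → IsKSubsetOf k Y X → Σ A λ x → x ∈ xs × Y ≐ F x) →
  (∀ {x y} → F x ≐ F y → x ≡ y) → AllPairs _≢_ xs →
  Enumerates k X (map F xs)
Enumerates-intro k X F xs sound complete F-injective distinct =
  (λ Y → mk⇔ (listed Y) (subset Y)) , AllPairs.map⁺ (AllPairs.map (λ x≢y Fx≐Fy → x≢y (F-injective Fx≐Fy)) distinct)
  where
  listed : ∀ Y → IsKSubsetOf k Y X → Any (Y ≐_) (map F xs)
  listed Y Y⊆X with complete Y Y⊆X
  ... | x , x∈xs , Y≐Fx = Any.map⁺ (lose {P = λ x → Y ≐ F x} x∈xs Y≐Fx)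
  subset : ∀ Y → Any (Y ≐_) (map F xs) → IsKSubsetOf k Y X
  subset Y Y∈ with find (Any.map⁻ Y∈)
  ... | x , x∈xs , Y≐Fx = IsKSubsetOf-≐ {k} {X} Y (F x) Y≐Fx (sound x∈xs)

Enumerates-[] : ∀ k X → (∀ Y → ¬ IsKSubsetOf k Y X) → Enumerates k X []
Enumerates-[] k X none = (λ Y → mk⇔ (λ Y⊆X → contradiction Y⊆X (none Y)) λ ()) , AllPairs.[]

enumerate-subsets : ∀ N K → Enumerates (+ K) (stdX (+ N)) (map bitsSet (choose N K))
enumerate-subsets N K = Enumerates-intro (+ K) (stdX (+ N)) bitsSet (choose N K) sound complete
  (Nonneg.toHSet-injective ℤP.+-injective _ _) (choose-distinct N K)
  where
  sound : ∀ {l} → l ∈ choose N K → IsKSubsetOf (+ K) (bitsSet l) (stdX (+ N))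
  sound {l} l∈ with choose-sound N K l∈
  ... | bits , sum≡K = bitsSet-subset l bits , trans (card-bitsSet l) (cong +_ sum≡K)
  complete : ∀ Y → IsKSubsetOf (+ K) Y (stdX (+ N)) → Σ (Vec ℕ N) λ l → l ∈ choose N K × Y ≐ bitsSet l
  complete Y (Y⊆X , cardY) with subsets-of-nonneg N Y Y⊆X
  ... | l , bits , Y≐l = l , subst (λ k → l ∈ choose N k) sum≡K (choose-complete l bits) , Y≐l
    where
    sum≡K : Vec.sum l ≡ K
    sum≡K = ℤP.+-injective (card-transport Y (bitsSet l) Y≐l (card-bitsSet l) cardY)

enumerate-multisets : ∀ m K → Enumerates (+ K) (stdX -[1+ m ]) (map multisetSet (multichoose (suc m) K))
enumerate-multisets m K = Enumerates-intro (+ K) (stdX -[1+ m ]) multisetSet (multichoose (suc m) K) sound complete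
  (Neg.toHSet-injective ℤP.+-injective _ _) (multichoose-distinct (suc m) K)
  where
  sound : ∀ {l} → l ∈ multichoose (suc m) K → IsKSubsetOf (+ K) (multisetSet l) (stdX -[1+ m ])
  sound {l} l∈ = multisetSet-subset l , trans (card-multisetSet l) (cong +_ (multichoose-sound (suc m) K l∈))
  complete : ∀ Y → IsKSubsetOf (+ K) Y (stdX -[1+ m ]) →
    Σ (Vec ℕ (suc m)) λ l → l ∈ multichoose (suc m) K × Y ≐ multisetSet l
  complete Y (Y⊆X , cardY) with subsets-of-neg m Y Y⊆X
  ... | l , inj₁ Y≐l = l , subst (λ k → l ∈ multichoose (suc m) k) sum≡K (multichoose-complete l) , Y≐l
    where
    sum≡K : Vec.sum l ≡ K
    sum≡K = ℤP.+-injective (card-transport Y (multisetSet l) Y≐l (card-multisetSet l) cardY)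
  ... | l , inj₂ Y≐l = contradiction (card-transport Y (complementSet l) Y≐l (card-complementSet l) cardY) λ ()

enumerate-complements : ∀ m t → Enumerates -[1+ m ℕ.+ t ] (stdX -[1+ m ]) (map complementSet (multichoose (suc m) t))
enumerate-complements m t =
  Enumerates-intro -[1+ m ℕ.+ t ] (stdX -[1+ m ]) complementSet (multichoose (suc m) t) sound complete
  (Neg.toHSet-injective ℤP.-[1+-injective _ _) (multichoose-distinct (suc m) t)
  where
  sound : ∀ {l} → l ∈ multichoose (suc m) t → IsKSubsetOf -[1+ m ℕ.+ t ] (complementSet l) (stdX -[1+ m ])
  sound {l} l∈ = complementSet-subset l ,
    trans (card-complementSet l) (cong (λ s → -[1+ m ℕ.+ s ]) (multichoose-sound (suc m) t l∈))
  complete : ∀ Y → IsKSubsetOf -[1+ m ℕ.+ t ] Y (stdX -[1+ m ]) →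
    Σ (Vec ℕ (suc m)) λ l → l ∈ multichoose (suc m) t × Y ≐ complementSet l
  complete Y (Y⊆X , cardY) with subsets-of-neg m Y Y⊆X
  ... | l , inj₁ Y≐l = contradiction (card-transport Y (multisetSet l) Y≐l (card-multisetSet l) cardY) λ ()
  ... | l , inj₂ Y≐l = l , subst (λ k → l ∈ multichoose (suc m) k) sum≡t (multichoose-complete l) , Y≐l
    where
    sum≡t : Vec.sum l ≡ t
    sum≡t = ℕP.+-cancelˡ-≡ m _ _ (ℤP.-[1+-injective (card-transport Y (complementSet l) Y≐l (card-complementSet l) cardY))

no-negative-subsets : ∀ N K → Enumerates -[1+ K ] (stdX (+ N)) []
no-negative-subsets N K = Enumerates-[] -[1+ K ] (stdX (+ N)) none
  where
  none : ∀ Y → ¬ IsKSubsetOf -[1+ K ] Y (stdX (+ N))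
  none Y (Y⊆X , cardY) with subsets-of-nonneg N Y Y⊆X
  ... | l , _ , Y≐l = contradiction (card-transport Y (bitsSet l) Y≐l (card-bitsSet l) cardY) λ ()

no-small-subsets : ∀ {m j} → j ℕ.< m → Enumerates -[1+ j ] (stdX -[1+ m ]) []
no-small-subsets {m} {j} j<m = Enumerates-[] -[1+ j ] (stdX -[1+ m ]) none
  where
  none : ∀ Y → ¬ IsKSubsetOf -[1+ j ] Y (stdX -[1+ m ])
  none Y (Y⊆X , cardY) with subsets-of-neg m Y Y⊆X
  ... | l , inj₁ Y≐l = contradiction (card-transport Y (multisetSet l) Y≐l (card-multisetSet l) cardY) λ ()
  ... | l , inj₂ Y≐l = ℕP.<⇒≱ j<m (subst (m ℕ.≤_) m+sum≡j (ℕP.m≤m+n m (Vec.sum l)))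
    where
    m+sum≡j : m ℕ.+ Vec.sum l ≡ j
    m+sum≡j = ℤP.-[1+-injective (card-transport Y (complementSet l) Y≐l (card-complementSet l) cardY)

subsetSum-map : ∀ {A : Set} k (F : A → HSet) (w : A → ℤ) xs → (∀ x → σ (F x) - tri k ≡ w x) →
  subsetSum k (map F xs) ≡ expPoly w xs
subsetSum-map k F w []       σ≡w = refl
subsetSum-map k F w (x ∷ xs) σ≡w = cong₂ _∷_ (cong (_, 1ℤ) (σ≡w x)) (subsetSum-map k F w xs σ≡w)

-1^-unit : ∀ k → -1ℤ ^ k ≡ 1ℤ ⊎ -1ℤ ^ k ≡ -1ℤ
-1^-unit zero    = inj₁ refl
-1^-unit (suc k) with -1^-unit k
... | inj₁ ≡1  = inj₂ (cong (-1ℤ *_) ≡1)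
... | inj₂ ≡-1 = inj₁ (cong (-1ℤ *_) ≡-1)

subsets-expansion : ∀ K d →
  QBinomIs (+ (K ℕ.+ d)) (+ K) (scaleL 1ℤ (subsetSum (+ K) (map bitsSet (choose (K ℕ.+ d) K))))
subsets-expansion K d =
  QBinomIs-cong (+ (K ℕ.+ d)) (+ K) (≋-sym (≋-trans (scaleL-1 _) (≡⇒≋ bridge))) (qbinom-subsets K d)
  where
  bridge : subsetSum (+ K) (map bitsSet (choose (K ℕ.+ d) K)) ≡ subsetPoly (K ℕ.+ d) K
  bridge = subsetSum-map (+ K) bitsSet _ (choose (K ℕ.+ d) K)
    λ l → cong (_- tri (+ K)) (Nonneg.σ-toHSet (Vec.map +_ l))

subsets-vanish : ∀ {N K} → N ℕ.< K →
  QBinomIs (+ N) (+ K) (scaleL 1ℤ (subsetSum (+ K) (map bitsSet (choose N K))))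
subsets-vanish {N} {K} N<K =
  subst (λ ls → QBinomIs (+ N) (+ K) (scaleL 1ℤ (subsetSum (+ K) (map bitsSet ls))))
        (sym (choose-empty N K N<K)) (qbinom-vanishes-above N<K)

multisets-expansion : ∀ m K →
  QBinomIs -[1+ m ] (+ K) (scaleL (-1ℤ ^ K) (subsetSum (+ K) (map multisetSet (multichoose (suc m) K))))
multisets-expansion m K =
  QBinomIs-cong -[1+ m ] (+ K) (≡⇒≋ (cong (scaleL (-1ℤ ^ K)) (sym bridge))) (qbinom-multisets m K)
  where
  bridge : subsetSum (+ K) (map multisetSet (multichoose (suc m) K)) ≡ multisetPoly (suc m) K
  bridge = subsetSum-map (+ K) multisetSet _ (multichoose (suc m) K)
    λ l → cong (_- tri (+ K)) (Neg.σ-toHSet (Vec.map +_ l))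

complements-expansion : ∀ m t →
  QBinomIs -[1+ m ] -[1+ m ℕ.+ t ]
    (scaleL (-1ℤ ^ t) (subsetSum -[1+ m ℕ.+ t ] (map complementSet (multichoose (suc m) t))))
complements-expansion m t =
  QBinomIs-cong -[1+ m ] -[1+ m ℕ.+ t ] (≡⇒≋ (cong (scaleL (-1ℤ ^ t)) (sym bridge))) (qbinom-complements m t)
  where
  bridge : subsetSum -[1+ m ℕ.+ t ] (map complementSet (multichoose (suc m) t)) ≡ complementPoly (suc m) t
  bridge = subsetSum-map -[1+ m ℕ.+ t ] complementSet _ (multichoose (suc m) t)
    λ l → cong (_- tri -[1+ m ℕ.+ t ]) (Neg.σ-toHSet (Vec.map -[1+_] l))

theorem4p5 : ∀ (n k : ℤ) →
    Σ (List HSet) λ Ys → Enumerates k (stdX n) Ys ×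
    Σ ℤ λ ε → (ε ≡ 1ℤ ⊎ ε ≡ -1ℤ)
      × QBinomIs n k (scaleL ε (subsetSum k Ys))
      × (0ℤ ≤ k → k ≤ n → ε ≡ 1ℤ)
      × (n < 0ℤ → 0ℤ ≤ k → ε ≡ -1ℤ ^ ∣ k ∣)
      × (k ≤ n → n < 0ℤ → ε ≡ -1ℤ ^ ∣ n - k ∣)
theorem4p5 (+ N) (+ K) with K ℕP.≤? N
... | no K≰N = _ , enumerate-subsets N K , 1ℤ , inj₁ refl , subsets-vanish (ℕP.≰⇒> K≰N) ,
  (λ _ _ → refl) , (λ { (ℤ.+<+ ()) }) , λ _ → λ { (ℤ.+<+ ()) }
... | yes K≤N with ℕP.m≤n⇒∃[o]m+o≡n K≤N
...   | d , refl = _ , enumerate-subsets (K ℕ.+ d) K , 1ℤ , inj₁ refl , subsets-expansion K d ,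
  (λ _ _ → refl) , (λ { (ℤ.+<+ ()) }) , λ _ → λ { (ℤ.+<+ ()) }
theorem4p5 (+ N) -[1+ K ] = [] , no-negative-subsets N K , 1ℤ , inj₁ refl , qbinom-vanishes-negative N K ,
  (λ ()) , (λ { (ℤ.+<+ ()) }) , λ _ → λ { (ℤ.+<+ ()) }
theorem4p5 -[1+ m ] (+ K) = _ , enumerate-multisets m K , -1ℤ ^ K , -1^-unit K , multisets-expansion m K ,
  (λ _ ()) , (λ _ _ → refl) , λ ()
theorem4p5 -[1+ m ] -[1+ j ] with m ℕP.≤? j
... | no m≰j = [] , no-small-subsets (ℕP.≰⇒> m≰j) , 1ℤ , inj₁ refl , qbinom-vanishes-between (ℕP.≰⇒> m≰j) ,
  (λ ()) , (λ _ ()) , λ { (ℤ.-≤- m≤j) _ → contradiction m≤j m≰j }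
... | yes m≤j with ℕP.m≤n⇒∃[o]m+o≡n m≤j
...   | t , refl = _ , enumerate-complements m t , -1ℤ ^ t , -1^-unit t , complements-expansion m t ,
  (λ ()) , (λ _ ()) , λ _ _ → cong (λ d → -1ℤ ^ ∣ d ∣) (sym (-[1+]-gap m t))
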